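{- Let $2\le k\le n-2$, let $v_1,\dots,v_{\binom nk}$ be the vertices of $\Delta(k,n)$ in descending lexicographic order, and let $\kappa=\kappa_{k,n}$ be the lifting function with $\kappa(v_i)=1$ for $1\le i\le\binom{n-1}{k-1}-1$ and $\kappa(v_i)=0$ otherwise. Let $\tilde\Delta(k,n)=\operatorname{conv}\{(v_i,\kappa(v_i))\}\subset\mathbb{R}^{n+1}$ be the lifted hypersimplex. For $i\in\{2,\dots,n-k+1\}$ consider the affine function $f_i(x)=1-x_1-x_i+x_{n+1}$ on $\mathbb{R}^{n+1}$. Then (1) each $f_i$ cuts out a lower facet of $\tilde\Delta(k,n)$ (i.e., $f_i\ge0$ on $\tilde\Delta(k,n)$ and the set where $f_i=0$ is a lower facet); (2) these facets are (lattice) isomorphic to pyramids of lattice height one over $\Delta(k-1,n-1)$. There are exactly $n-k$ such facets.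
   Context: The hypersimplex $\Delta(k,n)=\operatorname{conv}\{e_X : X\subseteq[n],\ |X|=k\}\subset\mathbb{R}^n$ with $e_X=\sum_{i\in X}e_i$; vertices are ordered in descending lexicographic order as 0/1-vectors (e.g., for $\Delta(2,4)$: $1100,1010,1001,0110,0101,0011$). A lower face of the lifted polytope is a face admitting an outer normal vector with negative last coordinate. A pyramid of lattice height one over a lattice polytope $Q$ is the convex hull of (a lattice-isomorphic copy of) $Q$ and an apex lying at lattice distance one from the affine hull of $Q$.
   Formalization: The lifted hypersimplex, its zero sets, outer normals, convex combinations and the pyramid over Δ(k−1,n−1) are taken over ℚ rather than over the reals. -}

module Defs where

open import Data.Nat as ℕ using (ℕ; zero; suc; _<ᵇ_)
open import Data.Nat.Combinatorics using (_C_)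
open import Data.Integer as ℤ using (ℤ; +_)
open import Data.Rational as ℚ using (ℚ; 0ℚ; 1ℚ; _+_; _*_; _-_; _≤_; _<_)
open import Data.Fin as Fin using (Fin; zero; suc; fromℕ)
open import Data.Bool using (Bool; true; false; if_then_else_)
open import Data.Vec as Vec using (Vec; []; _∷_; _∷ʳ_)
open import Data.List as List using (List; []; _∷_; _++_; length; lookup; [_])
open import Data.List.Relation.Unary.All using (All)
open import Data.Product using (Σ; ∃; _×_; _,_)
open import Function.Bundles using (_⇔_)
open import Relation.Binary.PropositionalEquality using (_≡_)

-- Points of Q^m (coordinates indexed by Fin m; coordinate x_{j+1} is index j)

Pt : ℕ → Set
Pt m = Fin m → ℚ

PtSet : ℕ → Set₁
PtSet m = Pt m → Set

_≐_ : ∀ {m} → Pt m → Pt m → Set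
x ≐ y = ∀ j → x j ≡ y j

sumFin : ∀ {m} → (Fin m → ℚ) → ℚ
sumFin {zero}  f = 0ℚ
sumFin {suc m} f = f zero + sumFin (λ j → f (suc j))

⟪_,_⟫ : ∀ {m} → Pt m → Pt m → ℚ
⟪ c , x ⟫ = sumFin (λ j → c j * x j)

ℤtoℚ : ℤ → ℚ
ℤtoℚ z = z ℚ./ 1

conv : ∀ {m} → List (Pt m) → PtSet m
conv {m} L x =
  Σ (Fin (length L) → ℚ) λ w →
    (∀ t → 0ℚ ≤ w t) ×
    (sumFin w ≡ 1ℚ) ×
    (∀ j → x j ≡ sumFin (λ t → w t * lookup L t j))

-- Hypersimplex Δ(k,n): vertices e_X, |X| = k, as 0/1-vectors listed in
-- DESCENDING lexicographic order (vectors starting with 1 come first).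

hyperVerts : (k n : ℕ) → List (Vec Bool n)
hyperVerts zero    zero    = Vec.replicate 0 false ∷ []
hyperVerts zero    (suc n) = List.map (false ∷_) (hyperVerts zero n)
hyperVerts (suc k) zero    = []
hyperVerts (suc k) (suc n) =
  List.map (true ∷_) (hyperVerts k n) ++ List.map (false ∷_) (hyperVerts (suc k) n)

b2ℚ : Bool → ℚ
b2ℚ true  = 1ℚ
b2ℚ false = 0ℚ

toPt : ∀ {m} → Vec Bool m → Pt m
toPt v j = b2ℚ (Vec.lookup v j)

hypersimplex : (k n : ℕ) → PtSet n
hypersimplex k n = conv (List.map toPt (hyperVerts k n))

-- With 0-based position t (i = t+1): κ = 1 iff t + 1 < C(n-1,k-1).

κ : (k n : ℕ) → (t : ℕ) → ℚ
κ k n t = if suc t <ᵇ ((n ℕ.∸ 1) C (k ℕ.∸ 1)) then 1ℚ else 0ℚ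

liftFrom : (k n : ℕ) → ℕ → List (Vec Bool n) → List (Pt (suc n))
liftFrom k n t []       = []
liftFrom k n t (v ∷ vs) =
  (λ j → Vec.lookup (Vec.map b2ℚ v ∷ʳ κ k n t) j) ∷ liftFrom k n (suc t) vs

liftedVerts : (k n : ℕ) → List (Pt (suc n))
liftedVerts k n = liftFrom k n 0 (hyperVerts k n)

liftedHypersimplex : (k n : ℕ) → PtSet (suc n)
liftedHypersimplex k n = conv (liftedVerts k n)

-- The affine function f_i(x) = 1 - x_1 - x_i + x_{n+1} on Q^{n+1}.
-- The coordinate x_i is given by its 0-based index j : Fin (suc n), i = j+1.

fAff : (n : ℕ) → Fin (suc n) → Pt (suc n) → ℚ
fAff n j x = ((1ℚ - x zero) - x j) + x (fromℕ n)

zeroSetIn : ∀ {m} → PtSet m → (Pt m → ℚ) → PtSet m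
zeroSetIn P f x = P x × f x ≡ 0ℚ

AffIndep : ∀ {m} → List (Pt m) → Set
AffIndep []        = Data.Unit.⊤
  where import Data.Unit
AffIndep (p₀ ∷ ps) =
  (c : Fin (length ps) → ℚ) →
  (∀ j → sumFin (λ t → c t * (lookup ps t j - p₀ j)) ≡ 0ℚ) →
  ∀ t → c t ≡ 0ℚ

HasDim : ∀ {m} → PtSet m → ℕ → Set
HasDim S d =
  (Σ (List _) λ ps → (length ps ≡ suc d) × All S ps × AffIndep ps) ×
  (∀ ps → All S ps → AffIndep ps → length ps ℕ.≤ suc d)

IsLowerFace : ∀ {d} → PtSet (suc d) → PtSet (suc d) → Set
IsLowerFace {d} P F =
  Σ (Pt (suc d)) λ c → Σ ℚ λ b →
    (c (fromℕ d) < 0ℚ) ×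
    (∀ x → P x → ⟪ c , x ⟫ ≤ b) ×
    (∀ x → F x ⇔ (P x × ⟪ c , x ⟫ ≡ b))

-- F is a facet of P: its dimension is one less than that of P
-- (used together with IsLowerFace, which makes F a face).
DimDropOne : ∀ {m} → PtSet m → PtSet m → Set
DimDropOne P F = Σ ℕ λ e → HasDim P (suc e) × HasDim F e

IsLowerFacet : ∀ {d} → PtSet (suc d) → PtSet (suc d) → Set
IsLowerFacet P F = IsLowerFace P F × DimDropOne P F

record IntAff (m₁ m₂ : ℕ) : Set where
  field
    mat : Fin m₂ → Fin m₁ → ℤ
    off : Fin m₂ → ℤ

applyAff : ∀ {m₁ m₂} → IntAff m₁ m₂ → Pt m₁ → Pt m₂
applyAff φ x i = sumFin (λ j → ℤtoℚ (IntAff.mat φ i j) * x j) + ℤtoℚ (IntAff.off φ i)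

-- F and G are lattice isomorphic: there are integral affine maps φ, ψ
-- mapping F into G and G into F which are mutually inverse on F and G
-- (hence restrict to mutually inverse lattice-preserving affine bijections
-- between the affine hulls).
LatticeIso : ∀ {m₁ m₂} → PtSet m₁ → PtSet m₂ → Set
LatticeIso {m₁} {m₂} F G =
  Σ (IntAff m₁ m₂) λ φ → Σ (IntAff m₂ m₁) λ ψ →
    (∀ x → F x → G (applyAff φ x)) ×
    (∀ y → G y → F (applyAff ψ y)) ×
    (∀ x → F x → applyAff ψ (applyAff φ x) ≐ x) ×
    (∀ y → G y → applyAff φ (applyAff ψ y) ≐ y)

-- The apex (e_{1..k},1) lies at lattice distance one from the affine hull
-- of Δ(k,m) × {0} (measured in the lattice of the affine hull of the pyramid).

ones-then-zeros : (k m : ℕ) → Vec Bool m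
ones-then-zeros k       zero    = []
ones-then-zeros zero    (suc m) = false ∷ ones-then-zeros zero m
ones-then-zeros (suc k) (suc m) = true ∷ ones-then-zeros k m

extend : ∀ {m} → Vec Bool m → ℚ → Pt (suc m)
extend v h j = Vec.lookup (Vec.map b2ℚ v ∷ʳ h) j

pyramidOverHypersimplex : (k m : ℕ) → PtSet (suc m)
pyramidOverHypersimplex k m =
  conv (List.map (λ v → extend v 0ℚ) (hyperVerts k m) ++ [ extend (ones-then-zeros k m) 1ℚ ])

{-# OPTIONS --safe #-}
-- κ lifts to height 1 exactly the vertices v with v₁ = 1 other than the lexicographically last of them,
-- v⋆ = 10⋯01⋯1. Hence f_i(v, κ(v)) = 1 − vᵢ at every lifted vertex except (v⋆, 0), where it vanishes
-- because v⋆ᵢ = 0 for i ≤ n − k + 1. So f_i ≥ 0 on the lifted polytope, and its zero set is the lower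
-- face with outer normal e₁ + eᵢ − e_{n+1} spanned by (v⋆, 0) and the lifts of the vertices with vᵢ = 1.
-- Deleting xᵢ and taking 1 − xᵢ as the new height sends the latter onto Δ(k−1, n−1) × {0} and (v⋆, 0)
-- to height 1; a unimodular shear along the height moves it onto the apex (1⋯10⋯0, 1) of the pyramid.
-- The dimensions n and n − 1 come from the equations Σ_{j≤n} x_j = k and f_i = 0 together with
-- explicit affine frames that are triangular in suitable coordinates. Finally the vertex
-- eᵢ + e_{n−k+2} + ⋯ + e_n (at height 0) lies on f_i = 0 but on no other f_{i′} = 0.
module Submission where

open import Defs

module Sums where

  open import Data.Nat using (zero; suc)
  open import Data.Fin as Fin using (Fin; zero; suc; punchIn)
  import Data.Fin.Properties as FinP
  open import Data.Vec.Functional using (insertAt)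
  open import Data.Rational as ℚ using (ℚ; 0ℚ; 1ℚ; _+_; _*_; _-_; -_; _≤_)
  import Data.Rational.Properties as ℚP
  open import Data.Empty using (⊥-elim)
  open import Function using (_∘_)
  open import Level using (0ℓ)
  open import Relation.Nullary using (yes; no)
  open import Relation.Nullary.Decidable.Core using (dec⇒maybe)
  open import Relation.Binary.PropositionalEquality
  import Tactic.RingSolver.Core.AlmostCommutativeRing as ACR
  open import Tactic.RingSolver using (solve-∀)

  ℚ-ring : ACR.AlmostCommutativeRing 0ℓ 0ℓ
  ℚ-ring = ACR.fromCommutativeRing ℚP.+-*-commutativeRing (λ x → dec⇒maybe (0ℚ ℚP.≟ x))

  *-nonneg : ∀ {p q} → 0ℚ ≤ p → 0ℚ ≤ q → 0ℚ ≤ p * q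
  *-nonneg {p} {q} 0≤p 0≤q =
    ℚP.nonNegative⁻¹ (p * q) {{ℚP.nonNeg*nonNeg⇒nonNeg p {{ℚ.nonNegative 0≤p}} q {{ℚ.nonNegative 0≤q}}}}

  p*q≡0⇒p≡0 : ∀ p q → p * q ≡ 0ℚ → q ≢ 0ℚ → p ≡ 0ℚ
  p*q≡0⇒p≡0 p q pq≡0 q≢0 = begin
    p                  ≡⟨ sym (ℚP.*-identityʳ p) ⟩
    p * 1ℚ             ≡⟨ cong (p *_) (sym (ℚP.*-inverseʳ q)) ⟩
    p * (q * ℚ.1/ q)   ≡⟨ sym (ℚP.*-assoc p q _) ⟩
    p * q * ℚ.1/ q     ≡⟨ cong (_* ℚ.1/ q) pq≡0 ⟩
    0ℚ * ℚ.1/ q        ≡⟨ ℚP.*-zeroˡ (ℚ.1/ q) ⟩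
    0ℚ                 ∎
    where
    open ≡-Reasoning
    instance
      q≠0 : ℚ.NonZero q
      q≠0 = ℚ.≢-nonZero q≢0

  p+q≡0⇒p≡0 : ∀ {p q} → 0ℚ ≤ p → 0ℚ ≤ q → p + q ≡ 0ℚ → p ≡ 0ℚ
  p+q≡0⇒p≡0 {p} {q} 0≤p 0≤q p+q≡0 = ℚP.≤-antisym p≤0 0≤p
    where
    open ℚP.≤-Reasoning
    p≤0 : p ≤ 0ℚ
    p≤0 = begin
      p      ≡⟨ sym (ℚP.+-identityʳ p) ⟩
      p + 0ℚ ≤⟨ ℚP.+-monoʳ-≤ p 0≤q ⟩
      p + q  ≡⟨ p+q≡0 ⟩
      0ℚ     ∎

  x-y≡0⇒x≡y : ∀ {x y} → x - y ≡ 0ℚ → x ≡ y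
  x-y≡0⇒x≡y {x} {y} x-y≡0 = trans (sym (x-y+y x y)) (trans (cong (_+ y) x-y≡0) (ℚP.+-identityˡ y))
    where
    x-y+y : ∀ x y → x - y + y ≡ x
    x-y+y = solve-∀ ℚ-ring

  0≤y-x⇒x≤y : ∀ {x y} → 0ℚ ≤ y - x → x ≤ y
  0≤y-x⇒x≤y {x} {y} 0≤y-x = begin
    x           ≡⟨ sym (ℚP.+-identityʳ x) ⟩
    x + 0ℚ      ≤⟨ ℚP.+-monoʳ-≤ x 0≤y-x ⟩
    x + (y - x) ≡⟨ x+[y-x] x y ⟩
    y           ∎
    where
    open ℚP.≤-Reasoning
    x+[y-x] : ∀ x y → x + (y - x) ≡ y
    x+[y-x] = solve-∀ ℚ-ring

  sumFin-cong : ∀ {m} {f g : Fin m → ℚ} → (∀ t → f t ≡ g t) → sumFin f ≡ sumFin g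
  sumFin-cong {zero}  f≗g = refl
  sumFin-cong {suc m} f≗g = cong₂ _+_ (f≗g zero) (sumFin-cong (f≗g ∘ suc))

  sumFin-zero : ∀ {m} {f : Fin m → ℚ} → (∀ t → f t ≡ 0ℚ) → sumFin f ≡ 0ℚ
  sumFin-zero {zero}  f≗0 = refl
  sumFin-zero {suc m} f≗0 = trans (cong₂ _+_ (f≗0 zero) (sumFin-zero (f≗0 ∘ suc))) (ℚP.+-identityˡ 0ℚ)

  sumFin-+ : ∀ {m} (f g : Fin m → ℚ) → sumFin (λ t → f t + g t) ≡ sumFin f + sumFin g
  sumFin-+ {zero}  f g = refl
  sumFin-+ {suc m} f g =
    trans (cong (f zero + g zero +_) (sumFin-+ (f ∘ suc) (g ∘ suc)))
          (interchange (f zero) (g zero) (sumFin (f ∘ suc)) (sumFin (g ∘ suc)))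
    where
    interchange : ∀ a b c d → a + b + (c + d) ≡ a + c + (b + d)
    interchange = solve-∀ ℚ-ring

  sumFin-*ˡ : ∀ {m} a (f : Fin m → ℚ) → sumFin (λ t → a * f t) ≡ a * sumFin f
  sumFin-*ˡ {zero}  a f = sym (ℚP.*-zeroʳ a)
  sumFin-*ˡ {suc m} a f =
    trans (cong (a * f zero +_) (sumFin-*ˡ a (f ∘ suc))) (sym (ℚP.*-distribˡ-+ a (f zero) _))

  sumFin-*ʳ : ∀ {m} a (f : Fin m → ℚ) → sumFin (λ t → f t * a) ≡ sumFin f * a
  sumFin-*ʳ a f =
    trans (sumFin-cong (λ t → ℚP.*-comm (f t) a)) (trans (sumFin-*ˡ a f) (ℚP.*-comm a _))

  sumFin-neg : ∀ {m} (f : Fin m → ℚ) → sumFin (λ t → - f t) ≡ - sumFin f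
  sumFin-neg {zero}  f = refl
  sumFin-neg {suc m} f =
    trans (cong (- f zero +_) (sumFin-neg (f ∘ suc))) (sym (ℚP.neg-distrib-+ (f zero) _))

  sumFin-- : ∀ {m} (f g : Fin m → ℚ) → sumFin (λ t → f t - g t) ≡ sumFin f - sumFin g
  sumFin-- f g = trans (sumFin-+ f (λ t → - g t)) (cong (sumFin f +_) (sumFin-neg g))

  sumFin-comm : ∀ {m n} (f : Fin m → Fin n → ℚ) →
    sumFin (λ s → sumFin (f s)) ≡ sumFin (λ t → sumFin (λ s → f s t))
  sumFin-comm {zero} {n} f = sym (sumFin-zero {n} (λ _ → refl))
  sumFin-comm {suc m} f =
    trans (cong (sumFin (f zero) +_) (sumFin-comm (f ∘ suc)))
          (sym (sumFin-+ (f zero) (λ t → sumFin (λ s → f (suc s) t))))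

  sumFin-nonneg : ∀ {m} {f : Fin m → ℚ} → (∀ t → 0ℚ ≤ f t) → 0ℚ ≤ sumFin f
  sumFin-nonneg {zero}  0≤f = ℚP.≤-refl
  sumFin-nonneg {suc m} 0≤f = ℚP.+-mono-≤ (0≤f zero) (sumFin-nonneg (0≤f ∘ suc))

  sumFin≡0⇒≡0 : ∀ {m} {f : Fin m → ℚ} → (∀ t → 0ℚ ≤ f t) → sumFin f ≡ 0ℚ → ∀ t → f t ≡ 0ℚ
  sumFin≡0⇒≡0 {f = f} 0≤f Σ≡0 zero =
    p+q≡0⇒p≡0 (0≤f zero) (sumFin-nonneg (0≤f ∘ suc)) Σ≡0
  sumFin≡0⇒≡0 {f = f} 0≤f Σ≡0 (suc t) =
    sumFin≡0⇒≡0 (0≤f ∘ suc)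
      (p+q≡0⇒p≡0 (sumFin-nonneg (0≤f ∘ suc)) (0≤f zero) (trans (ℚP.+-comm _ (f zero)) Σ≡0)) t

  sumFin-single : ∀ {m} (f : Fin m → ℚ) a → (∀ t → t ≢ a → f t ≡ 0ℚ) → sumFin f ≡ f a
  sumFin-single f zero f≡0 =
    trans (cong (f zero +_) (sumFin-zero (λ t → f≡0 (suc t) λ ()))) (ℚP.+-identityʳ (f zero))
  sumFin-single f (suc a) f≡0 =
    trans (cong (_+ sumFin (f ∘ suc)) (f≡0 zero λ ()))
    (trans (ℚP.+-identityˡ _) (sumFin-single (f ∘ suc) a (λ t t≢a → f≡0 (suc t) (t≢a ∘ FinP.suc-injective))))

  sumFin-insertAt : ∀ {m} (c : Fin m → ℚ) i γ (f : Fin (suc m) → ℚ) →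
    sumFin (λ t → insertAt c i γ t * f t) ≡ γ * f i + sumFin (λ s → c s * f (punchIn i s))
  sumFin-insertAt c zero γ f = refl
  sumFin-insertAt {suc m} c (suc i) γ f =
    trans (cong (c zero * f zero +_) (sumFin-insertAt (c ∘ suc) i γ (f ∘ suc)))
          (swap (c zero * f zero) (γ * f (suc i)) _)
    where
    swap : ∀ a b r → a + (b + r) ≡ b + (a + r)
    swap = solve-∀ ℚ-ring

  δ : ∀ {m} → Fin m → Fin m → ℚ
  δ a t with a Fin.≟ t
  ... | yes _ = 1ℚ
  ... | no  _ = 0ℚ

  δ-diag : ∀ {m} (a : Fin m) → δ a a ≡ 1ℚ
  δ-diag a with a Fin.≟ a
  ... | yes _  = refl
  ... | no a≢a = ⊥-elim (a≢a refl)

  δ-off : ∀ {m} {a t : Fin m} → t ≢ a → δ a t ≡ 0ℚ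
  δ-off {a = a} {t} t≢a with a Fin.≟ t
  ... | yes a≡t = ⊥-elim (t≢a (sym a≡t))
  ... | no  _   = refl

  δ-nonneg : ∀ {m} (a t : Fin m) → 0ℚ ≤ δ a t
  δ-nonneg a t with a Fin.≟ t
  ... | yes _ = ℚP.nonNegative⁻¹ 1ℚ
  ... | no  _ = ℚP.≤-refl

  sumFin-δ : ∀ {m} (a : Fin m) → sumFin (δ a) ≡ 1ℚ
  sumFin-δ a = trans (sumFin-single (δ a) a (λ _ → δ-off)) (δ-diag a)

  ⟪δ⟫ : ∀ {m} (a : Fin m) (x : Pt m) → ⟪ δ a , x ⟫ ≡ x a
  ⟪δ⟫ a x =
    trans (sumFin-single _ a (λ t t≢a → trans (cong (_* x t) (δ-off t≢a)) (ℚP.*-zeroˡ (x t))))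
          (trans (cong (_* x a) (δ-diag a)) (ℚP.*-identityˡ (x a)))

  combination : ∀ {m N} → (Fin N → ℚ) → (Fin N → Pt m) → Pt m
  combination w p i = sumFin (λ t → w t * p t i)

  ⟪⟫-cong : ∀ {m} (c : Pt m) {x y : Pt m} → x ≐ y → ⟪ c , x ⟫ ≡ ⟪ c , y ⟫
  ⟪⟫-cong c x≐y = sumFin-cong (λ i → cong (c i *_) (x≐y i))

  ⟪⟫-combination : ∀ {m N} (c : Pt m) (w : Fin N → ℚ) (p : Fin N → Pt m) →
    ⟪ c , combination w p ⟫ ≡ sumFin (λ t → w t * ⟪ c , p t ⟫)
  ⟪⟫-combination c w p =
    trans (sumFin-cong (λ i → trans (sym (sumFin-*ˡ (c i) (λ t → w t * p t i)))
                                    (sumFin-cong (λ t → reorder (c i) (w t) (p t i)))))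
    (trans (sumFin-comm (λ i t → w t * (c i * p t i))) (sumFin-cong (λ t → sumFin-*ˡ (w t) (λ i → c i * p t i))))
    where
    reorder : ∀ a b d → a * (b * d) ≡ b * (a * d)
    reorder = solve-∀ ℚ-ring

  sumFin-affine : ∀ {N} (w : Fin N → ℚ) → sumFin w ≡ 1ℚ → ∀ (f : Fin N → ℚ) b →
    sumFin (λ t → w t * (f t + b)) ≡ sumFin (λ t → w t * f t) + b
  sumFin-affine w Σw≡1 f b =
    trans (sumFin-cong (λ t → ℚP.*-distribˡ-+ (w t) (f t) b))
    (trans (sumFin-+ (λ t → w t * f t) (λ t → w t * b)) (cong (sumFin (λ t → w t * f t) +_)
      (trans (sumFin-*ʳ b w) (trans (cong (_* b) Σw≡1) (ℚP.*-identityˡ b)))))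

module IntegralAffineMap where

  open Sums
  open import Data.Nat using (zero; suc)
  open import Data.Fin as Fin using (Fin; zero; suc; fromℕ; inject₁)
  open import Data.Integer as ℤ using (ℤ; 0ℤ; 1ℤ; -1ℤ)
  open import Data.Bool using (Bool; true; false)
  open import Data.Rational as ℚ using (ℚ; 1ℚ; _+_; _*_; _-_; -_)
  import Data.Rational.Properties as ℚP
  open import Data.Empty using (⊥-elim)
  open import Function using (_∘_)
  open import Relation.Nullary using (yes; no)
  open import Relation.Binary.PropositionalEquality

  snoc : ∀ {m} {A : Set} → (Fin m → A) → A → Fin (suc m) → A
  snoc {zero}  f a zero    = a
  snoc {suc m} f a zero    = f zero
  snoc {suc m} f a (suc c) = snoc (f ∘ suc) a c

  snoc-inject₁ : ∀ {m} {A : Set} (f : Fin m → A) a c → snoc f a (inject₁ c) ≡ f c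
  snoc-inject₁ f a zero    = refl
  snoc-inject₁ f a (suc c) = snoc-inject₁ (f ∘ suc) a c

  snoc-last : ∀ {m} {A : Set} (f : Fin m → A) a → snoc f a (fromℕ m) ≡ a
  snoc-last {zero}  f a = refl
  snoc-last {suc m} f a = snoc-last (f ∘ suc) a

  row₁ : ∀ {m} → Fin m → ℤ → Fin m → ℤ
  row₁ a α c with a Fin.≟ c
  ... | yes _ = α
  ... | no  _ = 0ℤ

  row₂ : ∀ {m} → Fin m → ℤ → Fin m → ℤ → Fin m → ℤ
  row₂ a α b β c with a Fin.≟ c | b Fin.≟ c
  ... | yes _ | _     = α
  ... | no  _ | yes _ = β
  ... | no  _ | no  _ = 0ℤ

  row₁-δ : ∀ {m} (a : Fin m) α c → ℤtoℚ (row₁ a α c) ≡ ℤtoℚ α * δ a c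
  row₁-δ a α c with a Fin.≟ c
  ... | yes _ = sym (ℚP.*-identityʳ (ℤtoℚ α))
  ... | no  _ = sym (ℚP.*-zeroʳ (ℤtoℚ α))

  row₂-row₁ : ∀ {m} (a : Fin m) α b β → a ≢ b → ∀ c →
    ℤtoℚ (row₂ a α b β c) ≡ ℤtoℚ (row₁ a α c) + ℤtoℚ (row₁ b β c)
  row₂-row₁ a α b β a≢b c with a Fin.≟ c | b Fin.≟ c
  ... | yes refl | yes refl = ⊥-elim (a≢b refl)
  ... | yes _    | no _     = sym (ℚP.+-identityʳ (ℤtoℚ α))
  ... | no _     | yes _    = sym (ℚP.+-identityˡ (ℤtoℚ β))
  ... | no _     | no _     = refl

  ⟪row₁⟫ : ∀ {m} (a : Fin m) α (x : Pt m) → ⟪ ℤtoℚ ∘ row₁ a α , x ⟫ ≡ ℤtoℚ α * x a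
  ⟪row₁⟫ a α x = begin
    ⟪ ℤtoℚ ∘ row₁ a α , x ⟫
      ≡⟨ sumFin-cong (λ c → trans (cong (_* x c) (row₁-δ a α c)) (ℚP.*-assoc (ℤtoℚ α) (δ a c) (x c))) ⟩
    sumFin (λ c → ℤtoℚ α * (δ a c * x c))
      ≡⟨ sumFin-*ˡ (ℤtoℚ α) (λ c → δ a c * x c) ⟩
    ℤtoℚ α * ⟪ δ a , x ⟫
      ≡⟨ cong (ℤtoℚ α *_) (⟪δ⟫ a x) ⟩
    ℤtoℚ α * x a ∎
    where open ≡-Reasoning

  ⟪row₂⟫ : ∀ {m} (a : Fin m) α b β → a ≢ b → (x : Pt m) →
    ⟪ ℤtoℚ ∘ row₂ a α b β , x ⟫ ≡ ℤtoℚ α * x a + ℤtoℚ β * x b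
  ⟪row₂⟫ a α b β a≢b x = begin
    ⟪ ℤtoℚ ∘ row₂ a α b β , x ⟫
      ≡⟨ sumFin-cong (λ c → trans (cong (_* x c) (row₂-row₁ a α b β a≢b c))
                                  (ℚP.*-distribʳ-+ (x c) (ℤtoℚ (row₁ a α c)) (ℤtoℚ (row₁ b β c)))) ⟩
    sumFin (λ c → ℤtoℚ (row₁ a α c) * x c + ℤtoℚ (row₁ b β c) * x c)
      ≡⟨ sumFin-+ (λ c → ℤtoℚ (row₁ a α c) * x c) (λ c → ℤtoℚ (row₁ b β c) * x c) ⟩
    ⟪ ℤtoℚ ∘ row₁ a α , x ⟫ + ⟪ ℤtoℚ ∘ row₁ b β , x ⟫
      ≡⟨ cong₂ _+_ (⟪row₁⟫ a α x) (⟪row₁⟫ b β x) ⟩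
    ℤtoℚ α * x a + ℤtoℚ β * x b ∎
    where open ≡-Reasoning

  boolDiff : Bool → Bool → ℤ
  boolDiff true  false = 1ℤ
  boolDiff false true  = -1ℤ
  boolDiff _     _     = 0ℤ

  boolDiff-ℚ : ∀ a b → ℤtoℚ (boolDiff a b) ≡ b2ℚ a - b2ℚ b
  boolDiff-ℚ true  true  = refl
  boolDiff-ℚ true  false = refl
  boolDiff-ℚ false true  = refl
  boolDiff-ℚ false false = refl

  -boolDiff-ℚ : ∀ a b → ℤtoℚ (ℤ.- boolDiff a b) ≡ - (b2ℚ a - b2ℚ b)
  -boolDiff-ℚ true  true  = refl
  -boolDiff-ℚ true  false = refl
  -boolDiff-ℚ false true  = refl
  -boolDiff-ℚ false false = refl

  applyAff-row : ∀ {m₁ m₂} (θ : IntAff m₁ m₂) r {R : Fin m₁ → ℤ} {o : ℤ} →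
    IntAff.mat θ r ≡ R → IntAff.off θ r ≡ o → ∀ x → applyAff θ x r ≡ ⟪ ℤtoℚ ∘ R , x ⟫ + ℤtoℚ o
  applyAff-row θ r refl refl x = refl

  applyAff-cong : ∀ {m₁ m₂} (θ : IntAff m₁ m₂) {x y : Pt m₁} → x ≐ y → applyAff θ x ≐ applyAff θ y
  applyAff-cong θ x≐y i = cong (_+ ℤtoℚ (IntAff.off θ i)) (⟪⟫-cong (λ j → ℤtoℚ (IntAff.mat θ i j)) x≐y)

  applyAff-combination : ∀ {m₁ m₂ N} (θ : IntAff m₁ m₂) (w : Fin N → ℚ) (p : Fin N → Pt m₁) →
    sumFin w ≡ 1ℚ → applyAff θ (combination w p) ≐ combination w (applyAff θ ∘ p)
  applyAff-combination {m₁} θ w p Σw≡1 i =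
    trans (cong (_+ ℤtoℚ (IntAff.off θ i)) (⟪⟫-combination row w p))
          (sym (sumFin-affine w Σw≡1 (λ t → ⟪ row , p t ⟫) (ℤtoℚ (IntAff.off θ i))))
    where
    row : Pt m₁
    row j = ℤtoℚ (IntAff.mat θ i j)

module ConvexHull where

  open Sums
  open IntegralAffineMap
  open import Data.Fin using (Fin)
  open import Data.Rational as ℚ using (ℚ; 0ℚ; 1ℚ; _+_; _*_; _-_; -_; _≤_)
  import Data.Rational.Properties as ℚP
  open import Data.List using (List; length; lookup)
  open import Data.List.Membership.Propositional using (_∈_)
  open import Data.List.Membership.Propositional.Properties using (∈-lookup)
  open import Data.List.Relation.Unary.Any as Any using ()
  open import Data.List.Relation.Unary.Any.Properties using (lookup-index)
  open import Data.Product using (_,_; proj₁)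
  open import Data.Sum using (_⊎_; inj₁; inj₂)
  open import Function using (_∘_)
  open import Relation.Nullary using (yes; no)
  open import Relation.Binary.PropositionalEquality

  conv-resp : ∀ {m} {L : List (Pt m)} {x y : Pt m} → conv L x → x ≐ y → conv L y
  conv-resp (w , w≥0 , Σw≡1 , x≐Σ) x≐y = w , w≥0 , Σw≡1 , λ i → trans (sym (x≐y i)) (x≐Σ i)

  conv-lookup : ∀ {m} (L : List (Pt m)) t → conv L (lookup L t)
  conv-lookup L t = δ t , δ-nonneg t , sumFin-δ t , λ i → sym (⟪δ⟫ t (λ s → lookup L s i))

  conv-∈ : ∀ {m} {L : List (Pt m)} {p : Pt m} → p ∈ L → conv L p
  conv-∈ {L = L} p∈L =
    conv-resp {L = L} (conv-lookup L (Any.index p∈L)) (λ i → cong (λ q → q i) (sym (lookup-index p∈L)))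

  conv-combination : ∀ {m N} {M : List (Pt m)} (w : Fin N → ℚ) (p : Fin N → Pt m) →
    (∀ t → 0ℚ ≤ w t) → sumFin w ≡ 1ℚ → (∀ t → w t ≡ 0ℚ ⊎ conv M (p t)) → conv M (combination w p)
  conv-combination {M = M} w p w≥0 Σw≡1 p∈M = W , W≥0 , ΣW≡1 , W-combination
    where
    zeroˡ : ∀ {a} b → a ≡ 0ℚ → a * b ≡ 0ℚ
    zeroˡ b refl = ℚP.*-zeroˡ b
    u : ∀ t → Fin (length M) → ℚ
    u t with p∈M t
    ... | inj₁ _            = λ _ → 0ℚ
    ... | inj₂ (v , _)      = v
    u≥0 : ∀ t s → 0ℚ ≤ u t s
    u≥0 t with p∈M t
    ... | inj₁ _            = λ _ → ℚP.≤-refl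
    ... | inj₂ (_ , v≥0 , _) = v≥0
    w*Σu : ∀ t → w t * sumFin (u t) ≡ w t
    w*Σu t with p∈M t
    ... | inj₁ w≡0                 = trans (zeroˡ _ w≡0) (sym w≡0)
    ... | inj₂ (_ , _ , Σv≡1 , _) = trans (cong (w t *_) Σv≡1) (ℚP.*-identityʳ (w t))
    w*p : ∀ t i → w t * p t i ≡ w t * combination (u t) (lookup M) i
    w*p t i with p∈M t
    ... | inj₁ w≡0                = trans (zeroˡ (p t i) w≡0) (sym (zeroˡ _ w≡0))
    ... | inj₂ (_ , _ , _ , p≐Σ) = cong (w t *_) (p≐Σ i)
    W : Fin (length M) → ℚ
    W s = sumFin (λ t → w t * u t s)
    W≥0 : ∀ s → 0ℚ ≤ W s
    W≥0 s = sumFin-nonneg (λ t → *-nonneg (w≥0 t) (u≥0 t s))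
    ΣW≡1 : sumFin W ≡ 1ℚ
    ΣW≡1 = trans (sumFin-comm (λ s t → w t * u t s))
           (trans (sumFin-cong (λ t → trans (sumFin-*ˡ (w t) (u t)) (w*Σu t))) Σw≡1)
    W-combination : ∀ i → combination w p i ≡ combination W (lookup M) i
    W-combination i = sym (
      trans (sumFin-cong (λ s → sym (sumFin-*ʳ (lookup M s i) (λ t → w t * u t s))))
      (trans (sumFin-comm (λ s t → w t * u t s * lookup M s i))
      (sumFin-cong (λ t → trans (sumFin-cong (λ s → ℚP.*-assoc (w t) (u t s) _))
                 (trans (sumFin-*ˡ (w t) (λ s → u t s * lookup M s i)) (sym (w*p t i)))))))

  sumFin-slack : ∀ {m N} (c : Pt m) (b : ℚ) (w : Fin N → ℚ) (p : Fin N → Pt m) → sumFin w ≡ 1ℚ →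
    sumFin (λ t → w t * (b - ⟪ c , p t ⟫)) ≡ b - ⟪ c , combination w p ⟫
  sumFin-slack c b w p Σw≡1 = begin
    sumFin (λ t → w t * (b - ⟪ c , p t ⟫))    ≡⟨ sumFin-cong (λ t → cong (w t *_) (ℚP.+-comm b _)) ⟩
    sumFin (λ t → w t * (- ⟪ c , p t ⟫ + b))  ≡⟨ sumFin-affine w Σw≡1 _ b ⟩
    sumFin (λ t → w t * - ⟪ c , p t ⟫) + b    ≡⟨ cong (_+ b) (sumFin-cong (λ t → sym (ℚP.neg-distribʳ-* (w t) _))) ⟩
    sumFin (λ t → - (w t * ⟪ c , p t ⟫)) + b  ≡⟨ cong (_+ b) (sumFin-neg (λ t → w t * ⟪ c , p t ⟫)) ⟩
    - sumFin (λ t → w t * ⟪ c , p t ⟫) + b    ≡⟨ cong (λ s → - s + b) (sym (⟪⟫-combination c w p)) ⟩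
    - ⟪ c , combination w p ⟫ + b             ≡⟨ ℚP.+-comm _ b ⟩
    b - ⟪ c , combination w p ⟫               ∎
    where open ≡-Reasoning

  conv-slack : ∀ {m} {L : List (Pt m)} (c : Pt m) (b : ℚ) →
    (∀ {p} → p ∈ L → 0ℚ ≤ b - ⟪ c , p ⟫) → ∀ {x} → conv L x → 0ℚ ≤ b - ⟪ c , x ⟫
  conv-slack {L = L} c b L≥ (w , w≥0 , Σw≡1 , x≐Σ) =
    subst (0ℚ ≤_) (trans (sumFin-slack c b w (lookup L) Σw≡1) (cong (λ s → b - s) (sym (⟪⟫-cong c x≐Σ))))
      (sumFin-nonneg (λ t → *-nonneg (w≥0 t) (L≥ (∈-lookup t))))

  conv-image-supported : ∀ {m m'} {L : List (Pt m)} {M : List (Pt m')} (θ : IntAff m m') {x} (x∈L : conv L x) →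
    (∀ t → proj₁ x∈L t ≡ 0ℚ ⊎ conv M (applyAff θ (lookup L t))) → conv M (applyAff θ x)
  conv-image-supported {L = L} {M} θ (w , w≥0 , Σw≡1 , x≐Σ) supported =
    conv-resp {L = M} (conv-combination {M = M} w (applyAff θ ∘ lookup L) w≥0 Σw≡1 supported)
      (λ i → sym (trans (applyAff-cong θ x≐Σ i) (applyAff-combination θ w (lookup L) Σw≡1 i)))

  conv-image : ∀ {m m'} {L : List (Pt m)} {M : List (Pt m')} (θ : IntAff m m') →
    (∀ {p} → p ∈ L → conv M (applyAff θ p)) → ∀ {x} → conv L x → conv M (applyAff θ x)
  conv-image {L = L} {M} θ θL⊆M x∈L = conv-image-supported {L = L} {M} θ x∈L (λ t → inj₂ (θL⊆M (∈-lookup t)))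

  -- On the face where the slack vanishes, vertices of positive slack carry weight 0.
  conv-face-image : ∀ {m m'} {L : List (Pt m)} {M : List (Pt m')} (θ : IntAff m m') (c : Pt m) (b : ℚ) →
    (∀ {p} → p ∈ L → 0ℚ ≤ b - ⟪ c , p ⟫) →
    (∀ {p} → p ∈ L → b - ⟪ c , p ⟫ ≡ 0ℚ → conv M (applyAff θ p)) →
    ∀ {x} → conv L x → b - ⟪ c , x ⟫ ≡ 0ℚ → conv M (applyAff θ x)
  conv-face-image {L = L} {M} θ c b L≥ θface⊆M x∈L@(w , w≥0 , Σw≡1 , x≐Σ) slack≡0 =
    conv-image-supported {L = L} {M} θ x∈L support
    where
    slack : Fin (length L) → ℚ
    slack t = b - ⟪ c , lookup L t ⟫
    w*slack≡0 : ∀ t → w t * slack t ≡ 0ℚ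
    w*slack≡0 = sumFin≡0⇒≡0 (λ t → *-nonneg (w≥0 t) (L≥ (∈-lookup t)))
      (trans (sumFin-slack c b w (lookup L) Σw≡1) (trans (cong (λ s → b - s) (sym (⟪⟫-cong c x≐Σ))) slack≡0))
    support : ∀ t → w t ≡ 0ℚ ⊎ conv M (applyAff θ (lookup L t))
    support t with slack t ℚP.≟ 0ℚ
    ... | yes slack≡0 = inj₂ (θface⊆M (∈-lookup t) slack≡0)
    ... | no  slack≢0 = inj₁ (p*q≡0⇒p≡0 (w t) (slack t) (w*slack≡0 t) slack≢0)

module AffineIndependence where

  open Sums
  open ConvexHull
  open import Data.Nat as ℕ using (ℕ; zero; suc; z≤n; s≤s)
  import Data.Nat.Properties as ℕP
  open import Data.Fin as Fin using (Fin; zero; suc; punchIn; toℕ)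
  import Data.Fin.Properties as FinP
  open import Data.Vec.Functional using (insertAt)
  open import Data.Vec.Functional.Properties using (insertAt-punchIn)
  open import Data.Rational as ℚ using (ℚ; 0ℚ; 1ℚ; _+_; _*_; _-_; -_)
  import Data.Rational.Properties as ℚP
  open import Data.List as List using (List; _∷_; length; lookup)
  open import Data.List.Relation.Unary.All as All using (All)
  open import Data.List.Relation.Unary.All.Properties using (tabulate⁺)
  open import Data.List.Membership.Propositional.Properties using (∈-lookup)
  open import Data.Product using (∃-syntax; _×_; _,_)
  open import Data.Empty using (⊥-elim)
  open import Function using (_∘_)
  open import Relation.Nullary using (yes; no)
  open import Relation.Binary.PropositionalEquality
  open import Tactic.RingSolver using (solve-∀)

  diffs : ∀ {m} (p₀ : Pt m) (ps : List (Pt m)) → Fin (length ps) → Pt m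
  diffs p₀ ps t i = lookup ps t i - p₀ i

  RelationsDeterminedBy : ∀ {m K N} → (Fin K → Fin m) → (Fin N → Pt m) → Set
  RelationsDeterminedBy σ d = ∀ c → (∀ r → combination c d (σ r) ≡ 0ℚ) → ∀ i → combination c d i ≡ 0ℚ

  combination-insertAt : ∀ {m N} (v : Fin (suc N) → Pt m) t₀ (r c : Fin N → ℚ) i →
    combination (insertAt c t₀ (- sumFin (λ s → c s * r s))) v i
      ≡ sumFin (λ s → c s * (v (punchIn t₀ s) i - r s * v t₀ i))
  combination-insertAt v t₀ r c i = begin
    combination (insertAt c t₀ γ) v i
      ≡⟨ sumFin-insertAt c t₀ γ (λ t → v t i) ⟩
    γ * v t₀ i + sumFin (λ s → c s * v (punchIn t₀ s) i)
      ≡⟨ cong (_+ _) (trans (sym (ℚP.neg-distribˡ-* (sumFin (λ s → c s * r s)) (v t₀ i)))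
                            (cong -_ (sym (sumFin-*ʳ (v t₀ i) (λ s → c s * r s))))) ⟩
    - sumFin (λ s → c s * r s * v t₀ i) + sumFin (λ s → c s * v (punchIn t₀ s) i)
      ≡⟨ ℚP.+-comm (- sumFin (λ s → c s * r s * v t₀ i)) _ ⟩
    sumFin (λ s → c s * v (punchIn t₀ s) i) - sumFin (λ s → c s * r s * v t₀ i)
      ≡⟨ sym (sumFin-- (λ s → c s * v (punchIn t₀ s) i) (λ s → c s * r s * v t₀ i)) ⟩
    sumFin (λ s → c s * v (punchIn t₀ s) i - c s * r s * v t₀ i)
      ≡⟨ sumFin-cong (λ s → factor (c s) (v (punchIn t₀ s) i) (r s) (v t₀ i)) ⟩
    sumFin (λ s → c s * (v (punchIn t₀ s) i - r s * v t₀ i)) ∎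
    where
    open ≡-Reasoning
    γ : ℚ
    γ = - sumFin (λ s → c s * r s)
    factor : ∀ c x r y → c * x - c * r * y ≡ c * (x - r * y)
    factor = solve-∀ ℚ-ring

  pivotRatio : ∀ {m N} (v : Fin (suc N) → Pt (suc m)) t₀ → v t₀ zero ≢ 0ℚ → Fin N → ℚ
  pivotRatio v t₀ a≢0 s = v (punchIn t₀ s) zero * (ℚ.1/ v t₀ zero) {{ℚ.≢-nonZero a≢0}}

  pivotRatio-* : ∀ {m N} (v : Fin (suc N) → Pt (suc m)) t₀ (a≢0 : v t₀ zero ≢ 0ℚ) s →
    pivotRatio v t₀ a≢0 s * v t₀ zero ≡ v (punchIn t₀ s) zero
  pivotRatio-* v t₀ a≢0 s = begin
    v (punchIn t₀ s) zero * ℚ.1/ a * a   ≡⟨ ℚP.*-assoc (v (punchIn t₀ s) zero) (ℚ.1/ a) a ⟩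
    v (punchIn t₀ s) zero * (ℚ.1/ a * a) ≡⟨ cong (v (punchIn t₀ s) zero *_) (ℚP.*-inverseˡ a) ⟩
    v (punchIn t₀ s) zero * 1ℚ           ≡⟨ ℚP.*-identityʳ _ ⟩
    v (punchIn t₀ s) zero                ∎
    where
    open ≡-Reasoning
    a : ℚ
    a = v t₀ zero
    instance
      a≠0 : ℚ.NonZero a
      a≠0 = ℚ.≢-nonZero a≢0

  -- Gaussian elimination on the first coordinate.
  nontrivial-relation : ∀ {m N} → m ℕ.< N → (v : Fin N → Pt m) →
    ∃[ c ] (∃[ t ] c t ≢ 0ℚ) × (∀ i → combination c v i ≡ 0ℚ)
  nontrivial-relation {zero} {suc N} _ v =
    δ zero , (zero , λ δ≡0 → ℚP.1≢0 (trans (sym (δ-diag {suc N} zero)) δ≡0)) , λ ()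
  nontrivial-relation {suc m} {suc N} (s≤s m<N) v with FinP.all? (λ t → v t zero ℚP.≟ 0ℚ)
  ... | yes column≡0 =
    let (c , nontrivial , relation) = nontrivial-relation (ℕP.m<n⇒m<1+n m<N) (λ t → v t ∘ suc)
    in c , nontrivial , λ where
         zero    → sumFin-zero (λ t → trans (cong (c t *_) (column≡0 t)) (ℚP.*-zeroʳ (c t)))
         (suc i) → relation i
  ... | no column≢0 with FinP.¬∀⟶∃¬ _ _ (λ t → v t zero ℚP.≟ 0ℚ) column≢0
  ... | t₀ , a≢0 with nontrivial-relation m<N
                        (λ s i → v (punchIn t₀ s) (suc i) - pivotRatio v t₀ a≢0 s * v t₀ (suc i))
  ... | c′ , (s₁ , c′s₁≢0) , relation′ =
    c , (punchIn t₀ s₁ , λ c≡0 → c′s₁≢0 (trans (sym (insertAt-punchIn c′ t₀ γ s₁)) c≡0)) , relation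
    where
    r : Fin N → ℚ
    r = pivotRatio v t₀ a≢0
    γ : ℚ
    γ = - sumFin (λ s → c′ s * r s)
    c : Fin (suc N) → ℚ
    c = insertAt c′ t₀ γ
    relation : ∀ i → combination c v i ≡ 0ℚ
    relation zero = trans (combination-insertAt v t₀ r c′ zero)
      (sumFin-zero (λ s → trans (cong (λ y → c′ s * (v (punchIn t₀ s) zero - y)) (pivotRatio-* v t₀ a≢0 s))
        (trans (cong (c′ s *_) (ℚP.+-inverseʳ (v (punchIn t₀ s) zero))) (ℚP.*-zeroʳ (c′ s)))))
    relation (suc i) = trans (combination-insertAt v t₀ r c′ (suc i)) (relation′ i)

  affIndep-length≤ : ∀ {m K} (σ : Fin K → Fin m) (p₀ : Pt m) (ps : List (Pt m)) →
    RelationsDeterminedBy σ (diffs p₀ ps) → AffIndep (p₀ ∷ ps) → length ps ℕ.≤ K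
  affIndep-length≤ {K = K} σ p₀ ps determined indep with length ps ℕ.≤? K
  ... | yes ≤K = ≤K
  ... | no  ≰K =
    let (c , (t , ct≢0) , relation) = nontrivial-relation (ℕP.≰⇒> ≰K) (λ t r → diffs p₀ ps t (σ r))
    in ⊥-elim (ct≢0 (indep c (determined c relation) t))

  relation-at-negated-sum : ∀ {m N K} (c : Fin N → ℚ) (d : Fin N → Pt m) i (τ : Fin K → Fin m) →
    (∀ t → d t i + sumFin (λ r → d t (τ r)) ≡ 0ℚ) →
    (∀ r → combination c d (τ r) ≡ 0ℚ) → combination c d i ≡ 0ℚ
  relation-at-negated-sum {N = N} c d i τ d≡-Σ relation = begin
    sumFin (λ t → c t * d t i)
      ≡⟨ sumFin-cong (λ t → trans (cong (c t *_) (x+y≡0⇒x≡-y (d≡-Σ t))) (sym (ℚP.neg-distribʳ-* (c t) _))) ⟩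
    sumFin (λ t → - (c t * Σd t))
      ≡⟨ sumFin-neg (λ t → c t * Σd t) ⟩
    - sumFin (λ t → c t * Σd t)
      ≡⟨ cong -_ (sumFin-cong (λ t → sym (sumFin-*ˡ (c t) (λ r → d t (τ r))))) ⟩
    - sumFin (λ t → sumFin (λ r → c t * d t (τ r)))
      ≡⟨ cong -_ (sumFin-comm (λ t r → c t * d t (τ r))) ⟩
    - sumFin (λ r → combination c d (τ r))
      ≡⟨ cong -_ (sumFin-zero relation) ⟩
    0ℚ ∎
    where
    open ≡-Reasoning
    Σd : Fin N → ℚ
    Σd t = sumFin (λ r → d t (τ r))
    x+y≡0⇒x≡-y : ∀ {x y} → x + y ≡ 0ℚ → x ≡ - y
    x+y≡0⇒x≡-y {x} {y} x+y≡0 =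
      trans (sym (cancel x y)) (trans (cong (_+ - y) x+y≡0) (ℚP.+-identityˡ (- y)))
      where
      cancel : ∀ x y → x + y + - y ≡ x
      cancel = solve-∀ ℚ-ring

  relation-at-sum : ∀ {m N} (c : Fin N → ℚ) (d : Fin N → Pt m) i i₁ i₂ →
    (∀ t → d t i ≡ d t i₁ + d t i₂) →
    combination c d i₁ ≡ 0ℚ → combination c d i₂ ≡ 0ℚ → combination c d i ≡ 0ℚ
  relation-at-sum c d i i₁ i₂ d≡+ relation₁ relation₂ =
    trans (sumFin-cong (λ t → trans (cong (c t *_) (d≡+ t)) (ℚP.*-distribˡ-+ (c t) _ _)))
    (trans (sumFin-+ (λ t → c t * d t i₁) (λ t → c t * d t i₂))
    (trans (cong₂ _+_ relation₁ relation₂) (ℚP.+-identityˡ 0ℚ)))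

  ⟪⟫-- : ∀ {m} (a x y : Pt m) → ⟪ a , (λ i → x i - y i) ⟫ ≡ ⟪ a , x ⟫ - ⟪ a , y ⟫
  ⟪⟫-- a x y =
    trans (sumFin-cong (λ i → trans (ℚP.*-distribˡ-+ (a i) (x i) (- y i))
                                    (cong (a i * x i +_) (sym (ℚP.neg-distribʳ-* (a i) (y i))))))
          (sumFin-- (λ i → a i * x i) (λ i → a i * y i))

  affIndep-extend : ∀ {m} (a p₀ q : Pt m) (ps : List (Pt m)) → AffIndep (p₀ ∷ ps) →
    All (λ p → ⟪ a , p ⟫ ≡ ⟪ a , p₀ ⟫) ps → ⟪ a , q ⟫ ≢ ⟪ a , p₀ ⟫ → AffIndep (p₀ ∷ q ∷ ps)
  affIndep-extend {m} a p₀ q ps indep ps∈H q∉H c relation = c≡0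
    where
    D : Fin (suc (length ps)) → Pt m
    D = diffs p₀ (q ∷ ps)
    gap : ℚ
    gap = ⟪ a , q ⟫ - ⟪ a , p₀ ⟫
    on-H : ∀ t → ⟪ a , D (suc t) ⟫ ≡ 0ℚ
    on-H t = trans (⟪⟫-- a (lookup ps t) p₀)
      (trans (cong (_- ⟪ a , p₀ ⟫) (All.lookup ps∈H (∈-lookup t))) (ℚP.+-inverseʳ ⟪ a , p₀ ⟫))
    c₀*gap≡0 : c zero * gap ≡ 0ℚ
    c₀*gap≡0 = begin
      c zero * gap                      ≡⟨ cong (c zero *_) (sym (⟪⟫-- a q p₀)) ⟩
      c zero * ⟪ a , D zero ⟫           ≡⟨ sym (ℚP.+-identityʳ _) ⟩
      c zero * ⟪ a , D zero ⟫ + 0ℚ      ≡⟨ cong (c zero * ⟪ a , D zero ⟫ +_) (sym (sumFin-zero c*on-H)) ⟩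
      sumFin (λ t → c t * ⟪ a , D t ⟫)  ≡⟨ sym (⟪⟫-combination a c D) ⟩
      ⟪ a , combination c D ⟫           ≡⟨ sumFin-zero (λ i → trans (cong (a i *_) (relation i)) (ℚP.*-zeroʳ (a i))) ⟩
      0ℚ                                ∎
      where
      open ≡-Reasoning
      c*on-H : ∀ t → c (suc t) * ⟪ a , D (suc t) ⟫ ≡ 0ℚ
      c*on-H t = trans (cong (c (suc t) *_) (on-H t)) (ℚP.*-zeroʳ (c (suc t)))
    c₀≡0 : c zero ≡ 0ℚ
    c₀≡0 = p*q≡0⇒p≡0 (c zero) gap c₀*gap≡0 (q∉H ∘ x-y≡0⇒x≡y)
    c≡0 : ∀ t → c t ≡ 0ℚ
    c≡0 zero    = c₀≡0
    c≡0 (suc t) = indep (c ∘ suc) relation′ t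
      where
      c₀*≡0 : ∀ i → c zero * (q i - p₀ i) ≡ 0ℚ
      c₀*≡0 i = trans (cong (_* (q i - p₀ i)) c₀≡0) (ℚP.*-zeroˡ (q i - p₀ i))
      relation′ : ∀ i → combination (c ∘ suc) (diffs p₀ ps) i ≡ 0ℚ
      relation′ i = trans (sym (ℚP.+-identityˡ _))
        (trans (cong (_+ combination (c ∘ suc) (diffs p₀ ps) i) (sym (c₀*≡0 i))) (relation i))

  affIndep-extend-coord : ∀ {m} (i : Fin m) (p₀ q : Pt m) (ps : List (Pt m)) → AffIndep (p₀ ∷ ps) →
    All (λ p → p i ≡ p₀ i) ps → q i ≢ p₀ i → AffIndep (p₀ ∷ q ∷ ps)
  affIndep-extend-coord i p₀ q ps indep ps∈H q∉H =
    affIndep-extend (δ i) p₀ q ps indep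
      (All.map (λ {p} pi≡ → trans (⟪δ⟫ i p) (trans pi≡ (sym (⟪δ⟫ i p₀)))) ps∈H)
      (λ q∈H → q∉H (trans (sym (⟪δ⟫ i q)) (trans q∈H (⟪δ⟫ i p₀))))

  affIndep-triangular : ∀ {m N} (p₀ : Pt m) (p : Fin N → Pt m) (key : Fin N → Fin m) →
    (∀ s → p s (key s) ≢ p₀ (key s)) → (∀ s s′ → toℕ s ℕ.< toℕ s′ → p s′ (key s) ≡ p₀ (key s)) →
    AffIndep (p₀ ∷ List.tabulate p)
  affIndep-triangular {N = zero} p₀ p key differs agrees c _ ()
  affIndep-triangular {N = suc N} p₀ p key differs agrees =
    affIndep-extend-coord (key zero) p₀ (p zero) (List.tabulate (p ∘ suc))
      (affIndep-triangular p₀ (p ∘ suc) (key ∘ suc) (differs ∘ suc) (λ s s′ s<s′ → agrees (suc s) (suc s′) (s≤s s<s′)))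
      (tabulate⁺ (λ s → agrees zero (suc s) (s≤s z≤n)))
      (differs zero)

module Hypersimplex where

  open Sums
  open import Data.Nat as ℕ using (ℕ; zero; suc; z≤n; s≤s; _+_; _<ᵇ_)
  import Data.Nat.Properties as ℕP
  open import Data.Nat.Combinatorics using (_C_; nCk+nC[k+1]≡[n+1]C[k+1])
  open import Data.Fin as Fin using (Fin; zero; suc; fromℕ; inject₁; punchIn; toℕ)
  import Data.Fin.Properties as FinP
  open import Data.Bool using (Bool; true; false; T)
  open import Data.Unit using (tt)
  open import Data.Vec as Vec using (Vec; []; _∷_; countᵇ; _[_]≔_)
  import Data.Vec.Properties as VecP
  open import Data.Rational as ℚ using (ℚ; 0ℚ; 1ℚ; _*_; _-_; _≤_)
  import Data.Rational.Properties as ℚP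
  open import Algebra.Definitions.RawMonoid ℚP.+-rawMonoid using () renaming (_×_ to _·_)
  open import Data.List as List using (List; []; _∷_; _++_; length; lookup; [_])
  import Data.List.Properties as ListP
  open import Data.List.Membership.Propositional using (_∈_)
  open import Data.List.Membership.Propositional.Properties using (∈-map⁺; ∈-map⁻; ∈-++⁺ˡ; ∈-++⁺ʳ; ∈-++⁻; ∈-lookup)
  open import Data.List.Relation.Unary.Any using (here; there)
  open import Data.Product using (∃-syntax; _×_; _,_; proj₁; proj₂)
  open import Data.Sum using (_⊎_; inj₁; inj₂)
  open import Data.Empty using (⊥-elim)
  open import Function using (id; _∘_)
  open import Relation.Nullary using (¬_; yes; no)
  open import Relation.Binary.PropositionalEquality hiding ([_])

  weight : ∀ {n} → Vec Bool n → ℕ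
  weight = countᵇ id

  b2ℕ : Bool → ℕ
  b2ℕ true  = 1
  b2ℕ false = 0

  weight-∷ : ∀ b {n} (v : Vec Bool n) → weight (b ∷ v) ≡ b2ℕ b + weight v
  weight-∷ true  v = refl
  weight-∷ false v = refl

  weight-insertAt : ∀ {n} (v : Vec Bool n) i b → weight (Vec.insertAt v i b) ≡ b2ℕ b + weight v
  weight-insertAt v       zero    b = weight-∷ b v
  weight-insertAt (true ∷ v)  (suc i) b = trans (cong suc (weight-insertAt v i b)) (sym (ℕP.+-suc (b2ℕ b) (weight v)))
  weight-insertAt (false ∷ v) (suc i) b = weight-insertAt v i b

  weight-removeAt : ∀ {n} (v : Vec Bool (suc n)) i → weight v ≡ b2ℕ (Vec.lookup v i) + weight (Vec.removeAt v i)
  weight-removeAt v i =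
    trans (cong weight (sym (VecP.insertAt-removeAt v i))) (weight-insertAt (Vec.removeAt v i) i (Vec.lookup v i))

  weight-set-true : ∀ {n} (v : Vec Bool n) i → Vec.lookup v i ≡ false → weight (v [ i ]≔ true) ≡ suc (weight v)
  weight-set-true (false ∷ v) zero    refl = refl
  weight-set-true (true ∷ v)  (suc i) vᵢ≡0 = cong suc (weight-set-true v i vᵢ≡0)
  weight-set-true (false ∷ v) (suc i) vᵢ≡0 = weight-set-true v i vᵢ≡0

  weight-set-false : ∀ {n} (v : Vec Bool n) i → Vec.lookup v i ≡ true → suc (weight (v [ i ]≔ false)) ≡ weight v
  weight-set-false (true ∷ v)  zero    refl = refl
  weight-set-false (true ∷ v)  (suc i) vᵢ≡1 = cong suc (weight-set-false v i vᵢ≡1)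
  weight-set-false (false ∷ v) (suc i) vᵢ≡1 = weight-set-false v i vᵢ≡1

  ∈-hyperVerts⁻ : ∀ k n {v} → v ∈ hyperVerts k n → weight v ≡ k
  ∈-hyperVerts⁻ zero    zero    (here refl) = refl
  ∈-hyperVerts⁻ zero    (suc n) v∈ with ∈-map⁻ (false ∷_) v∈
  ... | _ , u∈ , refl = ∈-hyperVerts⁻ zero n u∈
  ∈-hyperVerts⁻ (suc k) (suc n) v∈ with ∈-++⁻ (List.map (true ∷_) (hyperVerts k n)) v∈
  ... | inj₁ v∈₁ with ∈-map⁻ (true ∷_) v∈₁
  ...   | _ , u∈ , refl = cong suc (∈-hyperVerts⁻ k n u∈)
  ∈-hyperVerts⁻ (suc k) (suc n) v∈ | inj₂ v∈₀ with ∈-map⁻ (false ∷_) v∈₀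
  ...   | _ , u∈ , refl = ∈-hyperVerts⁻ (suc k) n u∈

  ∈-hyperVerts⁺ : ∀ k {n} (v : Vec Bool n) → weight v ≡ k → v ∈ hyperVerts k n
  ∈-hyperVerts⁺ zero    []          _  = here refl
  ∈-hyperVerts⁺ zero    (false ∷ v) w≡ = ∈-map⁺ (false ∷_) (∈-hyperVerts⁺ zero v w≡)
  ∈-hyperVerts⁺ (suc k) (true ∷ v)  w≡ = ∈-++⁺ˡ (∈-map⁺ (true ∷_) (∈-hyperVerts⁺ k v (ℕP.suc-injective w≡)))
  ∈-hyperVerts⁺ (suc k) {suc n} (false ∷ v) w≡ =
    ∈-++⁺ʳ (List.map (true ∷_) (hyperVerts k n)) (∈-map⁺ (false ∷_) (∈-hyperVerts⁺ (suc k) v w≡))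

  length-hyperVerts : ∀ k n → length (hyperVerts k n) ≡ n C k
  length-hyperVerts zero    zero    = refl
  length-hyperVerts zero    (suc n) = trans (ListP.length-map (false ∷_) (hyperVerts zero n)) (length-hyperVerts zero n)
  length-hyperVerts (suc k) zero    = refl
  length-hyperVerts (suc k) (suc n) =
    trans (ListP.length-++ (List.map (true ∷_) (hyperVerts k n)))
    (trans (cong₂ _+_ (trans (ListP.length-map (true ∷_) (hyperVerts k n)) (length-hyperVerts k n))
                      (trans (ListP.length-map (false ∷_) (hyperVerts (suc k) n)) (length-hyperVerts (suc k) n)))
           (nCk+nC[k+1]≡[n+1]C[k+1] n k))

  hyperVerts-empty : ∀ k n → n ℕ.< k → hyperVerts k n ≡ []
  hyperVerts-empty (suc k) zero    _ = refl
  hyperVerts-empty (suc k) (suc n) (s≤s n<k)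
    rewrite hyperVerts-empty k n n<k | hyperVerts-empty (suc k) n (ℕP.m<n⇒m<1+n n<k) = refl

  -- The lexicographically smallest vertex 0⋯01⋯1.
  lastVert : (k n : ℕ) → Vec Bool n
  lastVert zero    n       = Vec.replicate n false
  lastVert (suc k) zero    = []
  lastVert (suc k) (suc n) with suc k ℕ.≤? n
  ... | yes _ = false ∷ lastVert (suc k) n
  ... | no  _ = true ∷ lastVert k n

  hyperVerts-∷ʳ-lastVert : ∀ k n → k ℕ.≤ n → ∃[ A ] hyperVerts k n ≡ A ++ [ lastVert k n ]
  hyperVerts-∷ʳ-lastVert zero zero _ = [] , refl
  hyperVerts-∷ʳ-lastVert zero (suc n) _ with hyperVerts-∷ʳ-lastVert zero n z≤n
  ... | A , eq = List.map (false ∷_) A , trans (cong (List.map (false ∷_)) eq) (ListP.map-++ (false ∷_) A _)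
  hyperVerts-∷ʳ-lastVert (suc k) (suc n) (s≤s k≤n) with suc k ℕ.≤? n
  ... | yes k<n with hyperVerts-∷ʳ-lastVert (suc k) n k<n
  ...   | B , eq = ones ++ List.map (false ∷_) B ,
          trans (cong (λ X → ones ++ List.map (false ∷_) X) eq)
          (trans (cong (ones ++_) (ListP.map-++ (false ∷_) B _)) (sym (ListP.++-assoc ones (List.map (false ∷_) B) _)))
    where ones = List.map (true ∷_) (hyperVerts k n)
  hyperVerts-∷ʳ-lastVert (suc k) (suc n) (s≤s k≤n) | no k≮n with hyperVerts-∷ʳ-lastVert k n k≤n
  ...   | A , eq = List.map (true ∷_) A ,
          trans (cong₂ (λ X Y → List.map (true ∷_) X ++ List.map (false ∷_) Y) eq
                       (hyperVerts-empty (suc k) n (s≤s (ℕP.≮⇒≥ k≮n))))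
          (trans (ListP.++-identityʳ _) (ListP.map-++ (true ∷_) A _))

  lookup-lastVert-false : ∀ k n (c : Fin n) → toℕ c + k ℕ.< n → Vec.lookup (lastVert k n) c ≡ false
  lookup-lastVert-false zero    n       c       _ = VecP.lookup-replicate c false
  lookup-lastVert-false (suc k) (suc n) c       c+k<n with suc k ℕ.≤? n
  lookup-lastVert-false (suc k) (suc n) zero    _           | yes _ = refl
  lookup-lastVert-false (suc k) (suc n) (suc c) (s≤s c+k<n) | yes _ = lookup-lastVert-false (suc k) n c c+k<n
  ... | no k≰n = ⊥-elim (k≰n (ℕP.≤-trans (ℕP.m≤n+m (suc k) (toℕ c)) (ℕP.≤-pred c+k<n)))

  lookup-lastVert-true : ∀ k n (c : Fin n) → n ℕ.≤ toℕ c + k → Vec.lookup (lastVert k n) c ≡ true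
  lookup-lastVert-true zero n c n≤c+k =
    ⊥-elim (ℕP.<⇒≱ (FinP.toℕ<n c) (ℕP.≤-trans n≤c+k (ℕP.≤-reflexive (ℕP.+-identityʳ (toℕ c)))))
  lookup-lastVert-true (suc k) (suc n) c       n≤c+k with suc k ℕ.≤? n
  lookup-lastVert-true (suc k) (suc n) zero    (s≤s n≤k)   | yes k<n = ⊥-elim (ℕP.<⇒≱ k<n n≤k)
  lookup-lastVert-true (suc k) (suc n) (suc c) (s≤s n≤c+k) | yes _   = lookup-lastVert-true (suc k) n c n≤c+k
  lookup-lastVert-true (suc k) (suc n) zero    _           | no _    = refl
  lookup-lastVert-true (suc k) (suc n) (suc c) n≤c+k       | no k≰n  =
    lookup-lastVert-true k n c (ℕP.≤-trans (ℕP.≤-pred (ℕP.≰⇒> k≰n)) (ℕP.m≤n+m k (toℕ c)))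

  extend-inject₁ : ∀ {n} (v : Vec Bool n) h c → extend v h (inject₁ c) ≡ b2ℚ (Vec.lookup v c)
  extend-inject₁ (b ∷ v) h zero    = refl
  extend-inject₁ (b ∷ v) h (suc c) = extend-inject₁ v h c

  extend-last : ∀ {n} (v : Vec Bool n) h → extend v h (fromℕ n) ≡ h
  extend-last []      h = refl
  extend-last (b ∷ v) h = extend-last v h

  κ-1 : ∀ k n s → suc s ℕ.< (n ℕ.∸ 1) C (k ℕ.∸ 1) → κ k n s ≡ 1ℚ
  κ-1 k n s s<C with suc s <ᵇ ((n ℕ.∸ 1) C (k ℕ.∸ 1)) | ℕP.<⇒<ᵇ s<C
  ... | true | _ = refl

  κ-0 : ∀ k n s → ¬ suc s ℕ.< (n ℕ.∸ 1) C (k ℕ.∸ 1) → κ k n s ≡ 0ℚ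
  κ-0 k n s s≮C with suc s <ᵇ ((n ℕ.∸ 1) C (k ℕ.∸ 1)) in eq
  ... | true  = ⊥-elim (s≮C (ℕP.<ᵇ⇒< (suc s) _ (subst T (sym eq) tt)))
  ... | false = refl

  liftFrom-++ : ∀ k n t (L₁ L₂ : List (Vec Bool n)) →
    liftFrom k n t (L₁ ++ L₂) ≡ liftFrom k n t L₁ ++ liftFrom k n (t + length L₁) L₂
  liftFrom-++ k n t []       L₂ = cong (λ s → liftFrom k n s L₂) (sym (ℕP.+-identityʳ t))
  liftFrom-++ k n t (v ∷ L₁) L₂ = cong (extend v (κ k n t) ∷_)
    (trans (liftFrom-++ k n (suc t) L₁ L₂)
           (cong (λ s → liftFrom k n (suc t) L₁ ++ liftFrom k n s L₂) (sym (ℕP.+-suc t (length L₁)))))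

  liftFrom-const : ∀ k n t h (L : List (Vec Bool n)) → (∀ s → t ℕ.≤ s → s ℕ.< t + length L → κ k n s ≡ h) →
    liftFrom k n t L ≡ List.map (λ v → extend v h) L
  liftFrom-const k n t h []      _      = refl
  liftFrom-const k n t h (v ∷ L) κ≡h =
    cong₂ _∷_ (cong (extend v) (κ≡h t ℕP.≤-refl (ℕP.m<m+n t (s≤s z≤n))))
      (liftFrom-const k n (suc t) h L
        (λ s t<s s<t+L → κ≡h s (ℕP.<⇒≤ t<s) (ℕP.≤-trans s<t+L (ℕP.≤-reflexive (sym (ℕP.+-suc t (length L)))))))

  module LiftedVertices (k n : ℕ) (k≤n : k ℕ.≤ n) where

    upper lower : List (Vec Bool n)
    upper = proj₁ (hyperVerts-∷ʳ-lastVert k n k≤n)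
    lower = hyperVerts (suc k) n

    -- The last vertex starting with 1: the first one lifted to height 0.
    v⋆ : Vec Bool (suc n)
    v⋆ = true ∷ lastVert k n

    height : Vec Bool (suc n) → ℚ
    height v = b2ℚ (Vec.head v)

    private
      upper-split : hyperVerts k n ≡ upper ++ [ lastVert k n ]
      upper-split = proj₂ (hyperVerts-∷ʳ-lastVert k n k≤n)

      C≡ : n C k ≡ suc (length upper)
      C≡ = trans (sym (length-hyperVerts k n)) (trans (cong length upper-split)
            (trans (ListP.length-++ upper) (ℕP.+-comm (length upper) 1)))

      ones zeros : List (Vec Bool (suc n))
      ones  = List.map (true ∷_) upper
      zeros = List.map (false ∷_) lower

      #ones : length ones ≡ length upper
      #ones = ListP.length-map (true ∷_) upper

      hyperVerts-split : hyperVerts (suc k) (suc n) ≡ ones ++ v⋆ ∷ zeros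
      hyperVerts-split =
        trans (cong (λ X → List.map (true ∷_) X ++ zeros) upper-split)
        (trans (cong (_++ zeros) (ListP.map-++ (true ∷_) upper [ lastVert k n ]))
               (ListP.++-assoc ones [ v⋆ ] zeros))

      κ-ones : ∀ s → 0 ℕ.≤ s → s ℕ.< length ones → κ (suc k) (suc n) s ≡ 1ℚ
      κ-ones s _ s<ones = κ-1 (suc k) (suc n) s (subst (suc s ℕ.<_) (sym C≡) (s≤s (subst (s ℕ.<_) #ones s<ones)))

      κ-v⋆ : κ (suc k) (suc n) (length ones) ≡ 0ℚ
      κ-v⋆ = κ-0 (suc k) (suc n) (length ones) (λ lt → ℕP.<-irrefl (sym (trans C≡ (cong suc (sym #ones)))) lt)

      κ-zeros : ∀ s → suc (length ones) ℕ.≤ s → s ℕ.< suc (length ones) + length zeros → κ (suc k) (suc n) s ≡ 0ℚ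
      κ-zeros s ones<s _ = κ-0 (suc k) (suc n) s
        (λ s<C → ℕP.<⇒≱ (ℕP.≤-pred (subst (suc s ℕ.<_) (trans C≡ (cong suc (sym #ones))) s<C)) (ℕP.<⇒≤ ones<s))

    liftedVerts-split : liftedVerts (suc k) (suc n) ≡
      List.map (λ v → extend v 1ℚ) ones ++ extend v⋆ 0ℚ ∷ List.map (λ v → extend v 0ℚ) zeros
    liftedVerts-split =
      trans (cong (liftFrom (suc k) (suc n) 0) hyperVerts-split)
      (trans (liftFrom-++ (suc k) (suc n) 0 ones (v⋆ ∷ zeros))
      (cong₂ _++_ (liftFrom-const (suc k) (suc n) 0 1ℚ ones κ-ones)
                  (cong₂ _∷_ (cong (extend v⋆) κ-v⋆)
                             (liftFrom-const (suc k) (suc n) (suc (length ones)) 0ℚ zeros κ-zeros))))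

    v⋆∈liftedVerts : extend v⋆ 0ℚ ∈ liftedVerts (suc k) (suc n)
    v⋆∈liftedVerts = subst (extend v⋆ 0ℚ ∈_) (sym liftedVerts-split)
      (∈-++⁺ʳ (List.map (λ v → extend v 1ℚ) ones) (here refl))

    weight-v⋆ : weight v⋆ ≡ suc k
    weight-v⋆ = cong suc (∈-hyperVerts⁻ k n (subst (lastVert k n ∈_) (sym upper-split) (∈-++⁺ʳ upper (here refl))))

    ∈-liftedVerts⁺ : ∀ v → weight v ≡ suc k → v ≢ v⋆ → extend v (height v) ∈ liftedVerts (suc k) (suc n)
    ∈-liftedVerts⁺ (true ∷ u) w≡ v≢v⋆
      with ∈-++⁻ upper (subst (u ∈_) upper-split (∈-hyperVerts⁺ k u (ℕP.suc-injective w≡)))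
    ... | inj₁ u∈ = subst (extend (true ∷ u) 1ℚ ∈_) (sym liftedVerts-split)
            (∈-++⁺ˡ (∈-map⁺ (λ v → extend v 1ℚ) (∈-map⁺ (true ∷_) u∈)))
    ... | inj₂ (here refl) = ⊥-elim (v≢v⋆ refl)
    ∈-liftedVerts⁺ (false ∷ u) w≡ _ = subst (extend (false ∷ u) 0ℚ ∈_) (sym liftedVerts-split)
      (∈-++⁺ʳ (List.map (λ v → extend v 1ℚ) ones)
        (there (∈-map⁺ (λ v → extend v 0ℚ) (∈-map⁺ (false ∷_) (∈-hyperVerts⁺ (suc k) u w≡)))))

    ∈-liftedVerts⁻ : ∀ {p} → p ∈ liftedVerts (suc k) (suc n) →
      p ≡ extend v⋆ 0ℚ ⊎ ∃[ v ] weight v ≡ suc k × p ≡ extend v (height v)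
    ∈-liftedVerts⁻ p∈ with ∈-++⁻ (List.map (λ v → extend v 1ℚ) ones) (subst (_ ∈_) liftedVerts-split p∈)
    ... | inj₁ p∈₁ with ∈-map⁻ (λ v → extend v 1ℚ) p∈₁
    ...   | v , v∈ , refl with ∈-map⁻ (true ∷_) v∈
    ...     | u , u∈ , refl = inj₂ (true ∷ u ,
              cong suc (∈-hyperVerts⁻ k n (subst (u ∈_) (sym upper-split) (∈-++⁺ˡ u∈))) , refl)
    ∈-liftedVerts⁻ p∈ | inj₂ (here refl) = inj₁ refl
    ∈-liftedVerts⁻ p∈ | inj₂ (there p∈₀) with ∈-map⁻ (λ v → extend v 0ℚ) p∈₀
    ...   | v , v∈ , refl with ∈-map⁻ (false ∷_) v∈
    ...     | u , u∈ , refl = inj₂ (false ∷ u , ∈-hyperVerts⁻ (suc k) n u∈ , refl)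

  true≢false : true ≢ false
  true≢false ()

  false≢true : ∀ {x y} → x ≡ false → y ≡ true → x ≢ y
  false≢true refl refl ()

  1-b2ℚ≥0 : ∀ b → 0ℚ ≤ 1ℚ - b2ℚ b
  1-b2ℚ≥0 true  = ℚP.≤-refl
  1-b2ℚ≥0 false = ℚP.nonNegative⁻¹ 1ℚ

  lookup-removeAt : ∀ {n} (u : Vec Bool (suc n)) i d → Vec.lookup (Vec.removeAt u i) d ≡ Vec.lookup u (punchIn i d)
  lookup-removeAt u i d = trans (cong (Vec.lookup (Vec.removeAt u i)) (sym (FinP.punchOut-punchIn i)))
                                (VecP.removeAt-punchOut u (FinP.punchInᵢ≢i i d ∘ sym))

  ones-then-zeros-first : ∀ {k m} → 1 ℕ.≤ k → Vec.lookup (ones-then-zeros k (suc m)) zero ≡ true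
  ones-then-zeros-first {suc k} _ = refl

  baseSum : ∀ {m} → Pt (suc m) → ℚ
  baseSum x = sumFin (λ c → x (inject₁ c))

  baseSum-extend : ∀ {m} (v : Vec Bool m) h → baseSum (extend v h) ≡ weight v · 1ℚ
  baseSum-extend []          h = refl
  baseSum-extend (true ∷ v)  h = cong (1ℚ ℚ.+_) (baseSum-extend v h)
  baseSum-extend (false ∷ v) h = trans (ℚP.+-identityˡ _) (baseSum-extend v h)

  baseSum-conv : ∀ {m} {L : List (Pt (suc m))} b →
    (∀ {p} → p ∈ L → baseSum p ≡ b) → ∀ {x} → conv L x → baseSum x ≡ b
  baseSum-conv {L = L} b L≡b {x} (w , _ , Σw≡1 , x≐Σ) = begin
    sumFin (λ c → x (inject₁ c))
      ≡⟨ sumFin-cong (x≐Σ ∘ inject₁) ⟩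
    sumFin (λ c → sumFin (λ t → w t * lookup L t (inject₁ c)))
      ≡⟨ sumFin-comm (λ c t → w t * lookup L t (inject₁ c)) ⟩
    sumFin (λ t → sumFin (λ c → w t * lookup L t (inject₁ c)))
      ≡⟨ sumFin-cong (λ t → trans (sumFin-*ˡ (w t) (λ c → lookup L t (inject₁ c))) (cong (w t *_) (L≡b (∈-lookup t)))) ⟩
    sumFin (λ t → w t * b)
      ≡⟨ sumFin-*ʳ b w ⟩
    sumFin w * b
      ≡⟨ trans (cong (_* b) Σw≡1) (ℚP.*-identityˡ b) ⟩
    b ∎
    where open ≡-Reasoning

module Facets where

  open Sums
  open ConvexHull
  open AffineIndependence
  open Hypersimplex
  open IntegralAffineMap
  open import Data.Nat as ℕ using (ℕ; zero; suc; z≤n; s≤s)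
  import Data.Nat.Properties as ℕP
  open import Data.Fin as Fin using (Fin; zero; suc; fromℕ; inject₁; punchIn; punchOut; toℕ)
  import Data.Fin.Properties as FinP
  open import Data.Fin.Relation.Unary.Top using (view; ‵fromℕ; ‵inj₁)
  open import Data.Integer as ℤ using (ℤ; 0ℤ; 1ℤ; -1ℤ)
  open import Data.Bool using (Bool; true; false)
  open import Data.Vec as Vec using (Vec; []; _∷_; _[_]≔_)
  import Data.Vec.Properties as VecP
  open import Data.Vec.Functional using (insertAt)
  open import Data.Vec.Functional.Properties using (insertAt-lookup; insertAt-punchIn)
  open import Data.Rational as ℚ using (ℚ; 0ℚ; 1ℚ; _+_; _*_; _-_; -_; _≤_; _<_)
  import Data.Rational.Properties as ℚP
  open import Algebra.Definitions.RawMonoid ℚP.+-rawMonoid using () renaming (_×_ to _·_)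
  open import Data.List as List using (List; []; _∷_; _++_; length; lookup; [_])
  import Data.List.Properties as ListP
  open import Data.List.Membership.Propositional using (_∈_)
  open import Data.List.Membership.Propositional.Properties using (∈-map⁺; ∈-map⁻; ∈-++⁺ˡ; ∈-++⁺ʳ; ∈-++⁻; ∈-lookup)
  open import Data.List.Relation.Unary.Any using (here)
  open import Data.List.Relation.Unary.All as All using (All; []; _∷_)
  open import Data.List.Relation.Unary.All.Properties using (tabulate⁺)
  open import Data.Product using (∃-syntax; _×_; _,_; proj₁; proj₂)
  open import Data.Sum using (inj₁; inj₂)
  open import Data.Empty using (⊥-elim)
  open import Function using (_∘_)
  open import Function.Bundles using (mk⇔)
  open import Relation.Nullary using (¬_; yes; no)
  open import Relation.Binary.PropositionalEquality hiding ([_])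
  open import Tactic.RingSolver using (solve-∀)

  -- Parameters are shifted against the paper: this is the facet f_{i+2} = 0 of the lifted Δ(k+1, n+2),
  -- and i + k ≤ n is the range 2 ≤ i + 2 ≤ (n+2) − (k+1) + 1.
  module Facet (k n : ℕ) (1≤k : 1 ℕ.≤ k) (k<n : k ℕ.< n) (i : Fin (suc n)) (i+k≤n : toℕ i ℕ.+ k ℕ.< suc n)
    where

    K N : ℕ
    K = suc k
    N = suc (suc n)

    k≤1+n : k ℕ.≤ suc n
    k≤1+n = ℕP.≤-trans (ℕP.<⇒≤ k<n) (ℕP.n≤1+n n)

    open LiftedVertices k (suc n) k≤1+n
      using (v⋆; height; v⋆∈liftedVerts; weight-v⋆; ∈-liftedVerts⁺; ∈-liftedVerts⁻)

    lv : Vec Bool (suc n)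
    lv = lastVert k (suc n)

    j last : Fin (suc N)
    j    = suc (inject₁ i)
    last = fromℕ N

    P F : PtSet (suc N)
    P = liftedHypersimplex K N
    F = zeroSetIn P (fAff N j)

    f : Pt (suc N) → ℚ
    f = fAff N j

    -- The supporting hyperplane

    normal : Pt (suc N)
    normal r = δ zero r + δ j r - δ last r

    ⟪normal⟫ : ∀ x → ⟪ normal , x ⟫ ≡ x zero + x j - x last
    ⟪normal⟫ x = begin
      ⟪ normal , x ⟫
        ≡⟨ sumFin-cong (λ r → distrib (δ zero r) (δ j r) (δ last r) (x r)) ⟩
      sumFin (λ r → δ zero r * x r + δ j r * x r - δ last r * x r)
        ≡⟨ sumFin-- (λ r → δ zero r * x r + δ j r * x r) (λ r → δ last r * x r) ⟩
      sumFin (λ r → δ zero r * x r + δ j r * x r) - ⟪ δ last , x ⟫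
        ≡⟨ cong (_- ⟪ δ last , x ⟫) (sumFin-+ (λ r → δ zero r * x r) (λ r → δ j r * x r)) ⟩
      ⟪ δ zero , x ⟫ + ⟪ δ j , x ⟫ - ⟪ δ last , x ⟫
        ≡⟨ cong₂ _-_ (cong₂ _+_ (⟪δ⟫ zero x) (⟪δ⟫ j x)) (⟪δ⟫ last x) ⟩
      x zero + x j - x last ∎
      where
      open ≡-Reasoning
      distrib : ∀ a b c y → (a + b - c) * y ≡ a * y + b * y - c * y
      distrib = solve-∀ ℚ-ring

    f≡1-⟪normal⟫ : ∀ x → f x ≡ 1ℚ - ⟪ normal , x ⟫
    f≡1-⟪normal⟫ x = trans (regroup (x zero) (x j) (x last)) (cong (λ y → 1ℚ - y) (sym (⟪normal⟫ x)))
      where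
      regroup : ∀ a b c → 1ℚ - a - b + c ≡ 1ℚ - (a + b - c)
      regroup = solve-∀ ℚ-ring

    lv-i : Vec.lookup lv i ≡ false
    lv-i = lookup-lastVert-false k (suc n) i i+k≤n

    f-extend : ∀ b u h → f (extend (b ∷ u) h) ≡ 1ℚ - b2ℚ b - b2ℚ (Vec.lookup u i) + h
    f-extend b u h = cong₂ (λ y z → 1ℚ - b2ℚ b - y + z) (extend-inject₁ u h i) (extend-last u h)

    f-vertex : ∀ b u → f (extend (b ∷ u) (b2ℚ b)) ≡ 1ℚ - b2ℚ (Vec.lookup u i)
    f-vertex b u = trans (f-extend b u (b2ℚ b)) (cancel (b2ℚ b) (b2ℚ (Vec.lookup u i)))
      where
      cancel : ∀ b y → 1ℚ - b - y + b ≡ 1ℚ - y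
      cancel = solve-∀ ℚ-ring

    f-v⋆ : f (extend v⋆ 0ℚ) ≡ 0ℚ
    f-v⋆ = trans (f-extend true lv 0ℚ) (cong (λ y → 1ℚ - 1ℚ - b2ℚ y + 0ℚ) lv-i)

    f-vertex-nonneg : ∀ {p} → p ∈ liftedVerts K N → 0ℚ ≤ f p
    f-vertex-nonneg p∈ with ∈-liftedVerts⁻ p∈
    ... | inj₁ refl               = ℚP.≤-reflexive (sym f-v⋆)
    ... | inj₂ (b ∷ u , _ , refl) = subst (0ℚ ≤_) (sym (f-vertex b u)) (1-b2ℚ≥0 (Vec.lookup u i))

    vertex-slack : ∀ {p} → p ∈ liftedVerts K N → 0ℚ ≤ 1ℚ - ⟪ normal , p ⟫
    vertex-slack {p} p∈ = subst (0ℚ ≤_) (f≡1-⟪normal⟫ p) (f-vertex-nonneg p∈)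

    f-nonneg : ∀ x → P x → 0ℚ ≤ f x
    f-nonneg x x∈P = subst (0ℚ ≤_) (sym (f≡1-⟪normal⟫ x)) (conv-slack normal 1ℚ vertex-slack x∈P)

    ⟪normal⟫≡1-f : ∀ x → ⟪ normal , x ⟫ ≡ 1ℚ - f x
    ⟪normal⟫≡1-f x = trans (sym (1-[1-y] ⟪ normal , x ⟫)) (cong (λ y → 1ℚ - y) (sym (f≡1-⟪normal⟫ x)))
      where
      1-[1-y] : ∀ y → 1ℚ - (1ℚ - y) ≡ y
      1-[1-y] = solve-∀ ℚ-ring

    F⇒⟪normal⟫≡1 : ∀ {x} → F x → ⟪ normal , x ⟫ ≡ 1ℚ
    F⇒⟪normal⟫≡1 {x} (_ , fx≡0) =
      trans (⟪normal⟫≡1-f x) (trans (cong (λ y → 1ℚ - y) fx≡0) (ℚP.+-identityʳ 1ℚ))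

    lowerFace : IsLowerFace P F
    lowerFace = normal , 1ℚ , normal-last<0 , bound , λ x → mk⇔ (to x) (from x)
      where
      normal-last<0 : normal last < 0ℚ
      normal-last<0 = subst (_< 0ℚ) (sym normal-last) (ℚP.negative⁻¹ (- 1ℚ))
        where
        open ≡-Reasoning
        normal-last : normal last ≡ - 1ℚ
        normal-last = begin
          δ zero last + δ j last - δ last last
            ≡⟨ cong₂ (λ a b → a + b - δ last last) (δ-off {a = zero} {t = last} λ ())
                     (δ-off {a = j} {t = last} (FinP.fromℕ≢inject₁ ∘ FinP.suc-injective)) ⟩
          0ℚ + 0ℚ - δ last last
            ≡⟨ cong (λ d → 0ℚ + 0ℚ - d) (δ-diag last) ⟩
          - 1ℚ ∎
      bound : ∀ x → P x → ⟪ normal , x ⟫ ≤ 1ℚ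
      bound x x∈P = 0≤y-x⇒x≤y (subst (0ℚ ≤_) (f≡1-⟪normal⟫ x) (f-nonneg x x∈P))
      to : ∀ x → F x → P x × ⟪ normal , x ⟫ ≡ 1ℚ
      to x x∈F = proj₁ x∈F , F⇒⟪normal⟫≡1 x∈F
      from : ∀ x → P x × ⟪ normal , x ⟫ ≡ 1ℚ → F x
      from x (x∈P , ⟪⟫≡1) =
        x∈P , trans (f≡1-⟪normal⟫ x) (trans (cong (λ y → 1ℚ - y) ⟪⟫≡1) (ℚP.+-inverseʳ 1ℚ))

    -- Dimensions

    baseSum-P : ∀ {x} → P x → baseSum x ≡ K · 1ℚ
    baseSum-P = baseSum-conv (K · 1ℚ) vertex-baseSum
      where
      vertex-baseSum : ∀ {p} → p ∈ liftedVerts K N → baseSum p ≡ K · 1ℚ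
      vertex-baseSum p∈ with ∈-liftedVerts⁻ p∈
      ... | inj₁ refl              = trans (baseSum-extend v⋆ 0ℚ) (cong (_· 1ℚ) weight-v⋆)
      ... | inj₂ (v , w≡K , refl) = trans (baseSum-extend v (height v)) (cong (_· 1ℚ) w≡K)

    first-coordinate-determined : ∀ {p q} → P p → P q →
      (q zero - p zero) + sumFin (λ c → q (suc (inject₁ c)) - p (suc (inject₁ c))) ≡ 0ℚ
    first-coordinate-determined {p} {q} p∈P q∈P =
      trans (sumFin-- (λ c → q (inject₁ c)) (λ c → p (inject₁ c)))
            (trans (cong₂ _-_ (baseSum-P q∈P) (baseSum-P p∈P)) (ℚP.+-inverseʳ (K · 1ℚ)))

    last-coordinate-determined : ∀ {p q} → F p → F q → q last - p last ≡ (q zero - p zero) + (q j - p j)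
    last-coordinate-determined {p} {q} (_ , fp≡0) (_ , fq≡0) =
      trans (expand (q zero) (q j) (q last) (p zero) (p j) (p last))
            (trans (cong ((q zero - p zero) + (q j - p j) +_) (cong₂ _-_ fq≡0 fp≡0)) (ℚP.+-identityʳ _))
      where
      expand : ∀ q₀ qⱼ q₁ p₀ pⱼ p₁ →
        q₁ - p₁ ≡ (q₀ - p₀) + (qⱼ - pⱼ) + ((1ℚ - q₀ - qⱼ + q₁) - (1ℚ - p₀ - pⱼ + p₁))
      expand = solve-∀ ℚ-ring

    P-length≤ : ∀ ps → All P ps → AffIndep ps → length ps ℕ.≤ suc N
    P-length≤ []        _                  _     = z≤n
    P-length≤ (p₀ ∷ qs) (p₀∈P ∷ qs∈P) indep = s≤s (affIndep-length≤ suc p₀ qs determined indep)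
      where
      determined : RelationsDeterminedBy suc (diffs p₀ qs)
      determined c relation zero    = relation-at-negated-sum c (diffs p₀ qs) zero (suc ∘ inject₁)
        (λ t → first-coordinate-determined p₀∈P (All.lookup qs∈P (∈-lookup t))) (relation ∘ inject₁)
      determined c relation (suc r) = relation r

    F-length≤ : ∀ ps → All F ps → AffIndep ps → length ps ℕ.≤ N
    F-length≤ []        _                  _     = z≤n
    F-length≤ (p₀ ∷ qs) (p₀∈F ∷ qs∈F) indep =
      s≤s (affIndep-length≤ (suc ∘ inject₁) p₀ qs determined indep)
      where
      d : Fin (length qs) → Pt (suc N)
      d = diffs p₀ qs
      q∈F : ∀ t → F (lookup qs t)
      q∈F t = All.lookup qs∈F (∈-lookup t)
      determined : RelationsDeterminedBy (suc ∘ inject₁) d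
      determined c relation zero = relation-at-negated-sum c d zero (suc ∘ inject₁)
        (λ t → first-coordinate-determined (proj₁ p₀∈F) (proj₁ (q∈F t))) relation
      determined c relation (suc r) with view r
      ... | ‵fromℕ          = relation-at-sum c d last zero j (λ t → last-coordinate-determined p₀∈F (q∈F t))
                                 (determined c relation zero) (relation i)
      ... | ‵inj₁ {i = r′} _ = relation r′

    lastBase : Fin (suc n)
    lastBase = fromℕ n

    lv-lastBase : Vec.lookup lv lastBase ≡ true
    lv-lastBase = lookup-lastVert-true k (suc n) lastBase
      (subst (λ m → suc n ℕ.≤ m ℕ.+ k) (sym (FinP.toℕ-fromℕ n))
             (ℕP.≤-trans (ℕP.≤-reflexive (ℕP.+-comm 1 n)) (ℕP.+-monoʳ-≤ n 1≤k)))

    <n⇒≢lastBase : ∀ {c} → toℕ c ℕ.< n → c ≢ lastBase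
    <n⇒≢lastBase c<n refl = ℕP.<-irrefl (FinP.toℕ-fromℕ n) c<n

    i≢lastBase : i ≢ lastBase
    i≢lastBase = <n⇒≢lastBase
      (ℕP.≤-trans (ℕP.≤-reflexive (ℕP.+-comm 1 (toℕ i))) (ℕP.≤-trans (ℕP.+-monoʳ-≤ (toℕ i) 1≤k) (ℕP.≤-pred i+k≤n)))

    weight-lv : weight lv ≡ k
    weight-lv = ℕP.suc-injective weight-v⋆

    vertex∈F : ∀ b u → weight (b ∷ u) ≡ K → Vec.lookup u i ≡ true → F (extend (b ∷ u) (b2ℚ b))
    vertex∈F b u w≡K uᵢ≡1 =
      conv-∈ (∈-liftedVerts⁺ (b ∷ u) w≡K λ { refl → true≢false (trans (sym uᵢ≡1) lv-i) }) ,
      trans (f-vertex b u) (cong (λ y → 1ℚ - b2ℚ y) uᵢ≡1)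

    u₀ : Vec Bool (suc n)
    u₀ = lv [ i ]≔ true

    p₀ : Pt (suc N)
    p₀ = extend (false ∷ u₀) 0ℚ

    u₀-i : Vec.lookup u₀ i ≡ true
    u₀-i = VecP.lookup∘update i lv true

    u₀-other : ∀ {c} → c ≢ i → Vec.lookup u₀ c ≡ Vec.lookup lv c
    u₀-other c≢i = VecP.lookup∘update′ c≢i lv true

    weight-u₀ : weight u₀ ≡ K
    weight-u₀ = trans (weight-set-true lv i lv-i) (cong suc weight-lv)

    p₀∈F : F p₀
    p₀∈F = vertex∈F false u₀ weight-u₀ u₀-i

    -- An affine frame of F around p₀: for each base coordinate c a vertex of F that differs from p₀
    -- at x_{c+2} (at x₁ when c is the last one) and agrees with p₀ at all earlier base coordinates.
    data Direction (c : Fin (suc n)) : Set where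
      facet-dir : c ≡ i → Direction c
      last-dir  : c ≢ i → c ≡ lastBase → Direction c
      zero-dir  : c ≢ i → c ≢ lastBase → Vec.lookup lv c ≡ false → Direction c
      one-dir   : c ≢ i → c ≢ lastBase → Vec.lookup lv c ≡ true → Direction c

    direction : ∀ c → Direction c
    direction c with c Fin.≟ i | c Fin.≟ lastBase | Vec.lookup lv c in lv-c
    ... | yes c≡i | _        | _     = facet-dir c≡i
    ... | no c≢i  | yes c≡ℓ  | _     = last-dir c≢i c≡ℓ
    ... | no c≢i  | no c≢ℓ   | false = zero-dir c≢i c≢ℓ lv-c
    ... | no c≢i  | no c≢ℓ   | true  = one-dir c≢i c≢ℓ lv-c

    frameVertex : ∀ {c} → Direction c → Pt (suc N)
    frameVertex     (facet-dir _)    = extend v⋆ 0ℚ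
    frameVertex     (last-dir _ _)   = extend (true ∷ u₀ [ lastBase ]≔ false) 1ℚ
    frameVertex {c} (zero-dir _ _ _) = extend (false ∷ (u₀ [ c ]≔ true) [ lastBase ]≔ false) 0ℚ
    frameVertex {c} (one-dir _ _ _)  = extend (true ∷ u₀ [ c ]≔ false) 1ℚ

    frameKey : ∀ {c} → Direction c → Fin (suc N)
    frameKey     (last-dir _ _)   = zero
    frameKey {c} (facet-dir _)    = suc (inject₁ c)
    frameKey {c} (zero-dir _ _ _) = suc (inject₁ c)
    frameKey {c} (one-dir _ _ _)  = suc (inject₁ c)

    u₀-lastBase : Vec.lookup u₀ lastBase ≡ true
    u₀-lastBase = trans (u₀-other (i≢lastBase ∘ sym)) lv-lastBase

    frameVertex∈F : ∀ {c} (d : Direction c) → F (frameVertex d)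
    frameVertex∈F (facet-dir _) = conv-∈ v⋆∈liftedVerts , f-v⋆
    frameVertex∈F (last-dir _ refl) =
      vertex∈F true (u₀ [ lastBase ]≔ false) (trans (weight-set-false u₀ lastBase u₀-lastBase) weight-u₀)
        (trans (VecP.lookup∘update′ i≢lastBase u₀ false) u₀-i)
    frameVertex∈F {c} (zero-dir c≢i c≢ℓ lv-c) =
      vertex∈F false ((u₀ [ c ]≔ true) [ lastBase ]≔ false)
        (ℕP.suc-injective (trans (weight-set-false (u₀ [ c ]≔ true) lastBase
                                   (trans (VecP.lookup∘update′ (c≢ℓ ∘ sym) u₀ true) u₀-lastBase))
                                 (trans (weight-set-true u₀ c (trans (u₀-other c≢i) lv-c)) (cong suc weight-u₀))))
        (trans (VecP.lookup∘update′ i≢lastBase (u₀ [ c ]≔ true) false)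
               (trans (VecP.lookup∘update′ (c≢i ∘ sym) u₀ true) u₀-i))
    frameVertex∈F {c} (one-dir c≢i _ lv-c) =
      vertex∈F true (u₀ [ c ]≔ false) (trans (weight-set-false u₀ c (trans (u₀-other c≢i) lv-c)) weight-u₀)
        (trans (VecP.lookup∘update′ (c≢i ∘ sym) u₀ false) u₀-i)

    private
      b2ℚ-injective : ∀ {x y} → b2ℚ x ≡ b2ℚ y → x ≡ y
      b2ℚ-injective {true}  {true}  _ = refl
      b2ℚ-injective {false} {false} _ = refl
      b2ℚ-injective {true}  {false} ()
      b2ℚ-injective {false} {true}  ()

      differs-at : ∀ s b u h → Vec.lookup u s ≢ Vec.lookup u₀ s →
        extend (b ∷ u) h (suc (inject₁ s)) ≢ p₀ (suc (inject₁ s))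
      differs-at s b u h uₛ≢ eq =
        uₛ≢ (b2ℚ-injective (trans (sym (extend-inject₁ u h s)) (trans eq (extend-inject₁ u₀ 0ℚ s))))

      agrees-at : ∀ s b u h → Vec.lookup u s ≡ Vec.lookup u₀ s →
        extend (b ∷ u) h (suc (inject₁ s)) ≡ p₀ (suc (inject₁ s))
      agrees-at s b u h uₛ≡ = trans (extend-inject₁ u h s) (trans (cong b2ℚ uₛ≡) (sym (extend-inject₁ u₀ 0ℚ s)))

    frameVertex-differs : ∀ {c} (d : Direction c) → frameVertex d (frameKey d) ≢ p₀ (frameKey d)
    frameVertex-differs (facet-dir refl) = differs-at i true lv 0ℚ (false≢true lv-i u₀-i)
    frameVertex-differs (last-dir _ _)   = ℚP.1≢0
    frameVertex-differs {c} (zero-dir c≢i c≢ℓ lv-c) =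
      differs-at c false ((u₀ [ c ]≔ true) [ lastBase ]≔ false) 0ℚ
        (false≢true (trans (u₀-other c≢i) lv-c)
          (trans (VecP.lookup∘update′ c≢ℓ (u₀ [ c ]≔ true) false) (VecP.lookup∘update c u₀ true)) ∘ sym)
    frameVertex-differs {c} (one-dir c≢i _ lv-c) =
      differs-at c true (u₀ [ c ]≔ false) 1ℚ
        (false≢true (VecP.lookup∘update c u₀ false) (trans (u₀-other c≢i) lv-c))

    frameVertex-agrees : ∀ {c} (d : Direction c) s → s ≢ c → s ≢ lastBase →
      frameVertex d (suc (inject₁ s)) ≡ p₀ (suc (inject₁ s))
    frameVertex-agrees (facet-dir refl) s s≢i _ = agrees-at s true lv 0ℚ (sym (u₀-other s≢i))
    frameVertex-agrees (last-dir _ refl) s _ s≢ℓ =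
      agrees-at s true (u₀ [ lastBase ]≔ false) 1ℚ (VecP.lookup∘update′ s≢ℓ u₀ false)
    frameVertex-agrees {c} (zero-dir _ _ _) s s≢c s≢ℓ =
      agrees-at s false ((u₀ [ c ]≔ true) [ lastBase ]≔ false) 0ℚ
        (trans (VecP.lookup∘update′ s≢ℓ (u₀ [ c ]≔ true) false) (VecP.lookup∘update′ s≢c u₀ true))
    frameVertex-agrees {c} (one-dir _ _ _) s s≢c _ =
      agrees-at s true (u₀ [ c ]≔ false) 1ℚ (VecP.lookup∘update′ s≢c u₀ false)

    frame : Fin (suc n) → Pt (suc N)
    frame c = frameVertex (direction c)

    key : Fin (suc n) → Fin (suc N)
    key c = frameKey (direction c)

    frameKey-base : ∀ {c} (d : Direction c) → c ≢ lastBase → frameKey d ≡ suc (inject₁ c)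
    frameKey-base (facet-dir _)    _   = refl
    frameKey-base (last-dir _ c≡ℓ) c≢ℓ = ⊥-elim (c≢ℓ c≡ℓ)
    frameKey-base (zero-dir _ _ _) _   = refl
    frameKey-base (one-dir _ _ _)  _   = refl

    F-frame-affIndep : AffIndep (p₀ ∷ List.tabulate frame)
    F-frame-affIndep = affIndep-triangular p₀ frame key (frameVertex-differs ∘ direction) agrees
      where
      agrees : ∀ s s′ → toℕ s ℕ.< toℕ s′ → frame s′ (key s) ≡ p₀ (key s)
      agrees s s′ s<s′ = subst (λ r → frame s′ r ≡ p₀ r) (sym (frameKey-base (direction s) s≢ℓ))
                           (frameVertex-agrees (direction s′) s (λ { refl → ℕP.<-irrefl refl s<s′ }) s≢ℓ)
        where
        s≢ℓ : s ≢ lastBase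
        s≢ℓ = <n⇒≢lastBase (ℕP.<-≤-trans s<s′ (FinP.toℕ≤pred[n] s′))

    F-dim : HasDim F (suc n)
    F-dim = (p₀ ∷ List.tabulate frame , cong suc (ListP.length-tabulate frame) ,
             p₀∈F ∷ tabulate⁺ (frameVertex∈F ∘ direction) , F-frame-affIndep) , F-length≤

    offCoordinate : ∃[ z ] z ≢ i × Vec.lookup lv z ≡ false
    offCoordinate with i Fin.≟ zero
    ... | no i≢0  = zero , i≢0 ∘ sym , lookup-lastVert-false k (suc n) zero (s≤s (ℕP.<⇒≤ k<n))
    ... | yes i≡0 = one , (λ one≡i → 1≢0 (trans (sym toℕ-one) (cong toℕ (trans one≡i i≡0)))) ,
                    lookup-lastVert-false k (suc n) one (subst (λ m → m ℕ.+ k ℕ.< suc n) (sym toℕ-one) (s≤s k<n))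
      where
      1<1+n : 1 ℕ.< suc n
      1<1+n = s≤s (ℕP.≤-trans 1≤k (ℕP.<⇒≤ k<n))
      one : Fin (suc n)
      one = Fin.fromℕ< 1<1+n
      toℕ-one : toℕ one ≡ 1
      toℕ-one = FinP.toℕ-fromℕ< 1<1+n
      1≢0 : 1 ≢ 0
      1≢0 ()

    z : Fin (suc n)
    z = proj₁ offCoordinate

    offVertex : Pt (suc N)
    offVertex = extend (false ∷ lv [ z ]≔ true) 0ℚ

    offVertex∈P : P offVertex
    offVertex∈P = conv-∈ (∈-liftedVerts⁺ (false ∷ lv [ z ]≔ true)
                           (trans (weight-set-true lv z (proj₂ (proj₂ offCoordinate))) (cong suc weight-lv)) λ ())

    ⟪normal⟫-offVertex : ⟪ normal , offVertex ⟫ ≡ 0ℚ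
    ⟪normal⟫-offVertex = trans (⟪normal⟫≡1-f offVertex) (cong (λ y → 1ℚ - y) f-offVertex)
      where
      f-offVertex : f offVertex ≡ 1ℚ
      f-offVertex = trans (f-vertex false (lv [ z ]≔ true))
        (cong (λ y → 1ℚ - b2ℚ y)
              (trans (VecP.lookup∘update′ (proj₁ (proj₂ offCoordinate) ∘ sym) lv true) lv-i))

    P-dim : HasDim P N
    P-dim = (p₀ ∷ offVertex ∷ List.tabulate frame , cong (λ m → suc (suc m)) (ListP.length-tabulate frame) ,
             proj₁ p₀∈F ∷ offVertex∈P ∷ tabulate⁺ (proj₁ ∘ frameVertex∈F ∘ direction) , indep) , P-length≤
      where
      indep : AffIndep (p₀ ∷ offVertex ∷ List.tabulate frame)
      indep = affIndep-extend normal p₀ offVertex (List.tabulate frame) F-frame-affIndep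
        (tabulate⁺ {f = frame} λ c → trans (F⇒⟪normal⟫≡1 (frameVertex∈F (direction c))) (sym (F⇒⟪normal⟫≡1 p₀∈F)))
        (λ eq → ℚP.1≢0 (trans (sym (F⇒⟪normal⟫≡1 p₀∈F)) (trans (sym eq) ⟪normal⟫-offVertex)))

    dimDrop : DimDropOne P F
    dimDrop = suc n , P-dim , F-dim

    -- The lattice isomorphism onto the pyramid

    top : Fin N
    top = fromℕ (suc n)

    src : Fin n → Fin (suc N)
    src d = suc (inject₁ (punchIn i d))

    apexBase : Vec Bool (suc n)
    apexBase = ones-then-zeros k (suc n)

    apexBase-first : Vec.lookup apexBase zero ≡ true
    apexBase-first = ones-then-zeros-first 1≤k

    -- Shearing along the height moves the image of v⋆ onto the apex of the pyramid.
    shift : Fin n → ℤ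
    shift d = boolDiff (Vec.lookup apexBase (suc d)) (Vec.lookup lv (punchIn i d))

    shiftℚ : Fin n → ℚ
    shiftℚ d = b2ℚ (Vec.lookup apexBase (suc d)) - b2ℚ (Vec.lookup lv (punchIn i d))

    shift≡ : ∀ d → ℤtoℚ (shift d) ≡ shiftℚ d
    shift≡ d = boolDiff-ℚ (Vec.lookup apexBase (suc d)) (Vec.lookup lv (punchIn i d))

    -shift≡ : ∀ d → ℤtoℚ (ℤ.- shift d) ≡ - shiftℚ d
    -shift≡ d = -boolDiff-ℚ (Vec.lookup apexBase (suc d)) (Vec.lookup lv (punchIn i d))

    φ-row : Fin (suc n) → Fin (suc N) → ℤ
    φ-row zero    = row₁ zero 1ℤ
    φ-row (suc d) = row₂ (src d) 1ℤ j (ℤ.- shift d)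

    φ-off : Fin (suc n) → ℤ
    φ-off zero    = 0ℤ
    φ-off (suc d) = shift d

    φ : IntAff (suc N) N
    φ = record { mat = snoc φ-row (row₁ j -1ℤ) ; off = snoc φ-off 1ℤ }

    ψ-row : Fin n → Fin N → ℤ
    ψ-row d = row₂ (inject₁ (suc d)) 1ℤ top (ℤ.- shift d)

    ψ-mat : Fin (suc N) → Fin N → ℤ
    ψ-mat zero    = row₁ zero 1ℤ
    ψ-mat (suc r) = snoc (insertAt ψ-row i (row₁ top -1ℤ)) (row₂ zero 1ℤ top -1ℤ) r

    ψ-off : Fin (suc N) → ℤ
    ψ-off zero    = 0ℤ
    ψ-off (suc r) = snoc (insertAt (λ _ → 0ℤ) i 1ℤ) 0ℤ r

    ψ : IntAff N (suc N)
    ψ = record { mat = ψ-mat ; off = ψ-off }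

    φ-first : ∀ x → applyAff φ x zero ≡ x zero
    φ-first x = trans (applyAff-row φ zero refl refl x)
      (trans (cong (_+ 0ℚ) (⟪row₁⟫ zero 1ℤ x)) (trans (ℚP.+-identityʳ _) (ℚP.*-identityˡ (x zero))))

    φ-base : ∀ x d → applyAff φ x (inject₁ (suc d)) ≡ x (src d) + shiftℚ d * (1ℚ - x j)
    φ-base x d = begin
      applyAff φ x (inject₁ (suc d))
        ≡⟨ applyAff-row φ (inject₁ (suc d)) (snoc-inject₁ φ-row _ (suc d)) (snoc-inject₁ φ-off _ (suc d)) x ⟩
      ⟪ ℤtoℚ ∘ row₂ (src d) 1ℤ j (ℤ.- shift d) , x ⟫ + ℤtoℚ (shift d)
        ≡⟨ cong₂ _+_ (⟪row₂⟫ (src d) 1ℤ j (ℤ.- shift d) src≢j x) (shift≡ d) ⟩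
      1ℚ * x (src d) + ℤtoℚ (ℤ.- shift d) * x j + shiftℚ d
        ≡⟨ cong (λ s → 1ℚ * x (src d) + s * x j + shiftℚ d) (-shift≡ d) ⟩
      1ℚ * x (src d) + - shiftℚ d * x j + shiftℚ d
        ≡⟨ rearrange (x (src d)) (x j) (shiftℚ d) ⟩
      x (src d) + shiftℚ d * (1ℚ - x j) ∎
      where
      open ≡-Reasoning
      src≢j : src d ≢ j
      src≢j = FinP.punchInᵢ≢i i d ∘ FinP.inject₁-injective ∘ FinP.suc-injective
      rearrange : ∀ s t D → 1ℚ * s + - D * t + D ≡ s + D * (1ℚ - t)
      rearrange = solve-∀ ℚ-ring

    φ-top : ∀ x → applyAff φ x top ≡ 1ℚ - x j
    φ-top x = trans (applyAff-row φ top (snoc-last φ-row _) (snoc-last φ-off _) x)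
      (trans (cong (_+ 1ℚ) (⟪row₁⟫ j -1ℤ x)) (rearrange (x j)))
      where
      rearrange : ∀ t → ℤtoℚ -1ℤ * t + 1ℚ ≡ 1ℚ - t
      rearrange = solve-∀ ℚ-ring

    ψ-first : ∀ y → applyAff ψ y zero ≡ y zero
    ψ-first y = trans (applyAff-row ψ zero refl refl y)
      (trans (cong (_+ 0ℚ) (⟪row₁⟫ zero 1ℤ y)) (trans (ℚP.+-identityʳ _) (ℚP.*-identityˡ (y zero))))

    ψ-facet : ∀ y → applyAff ψ y j ≡ 1ℚ - y top
    ψ-facet y = trans (applyAff-row ψ j (trans (snoc-inject₁ _ _ i) (insertAt-lookup ψ-row i _))
                                        (trans (snoc-inject₁ _ _ i) (insertAt-lookup (λ _ → 0ℤ) i _)) y)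
      (trans (cong (_+ 1ℚ) (⟪row₁⟫ top -1ℤ y)) (rearrange (y top)))
      where
      rearrange : ∀ t → ℤtoℚ -1ℤ * t + 1ℚ ≡ 1ℚ - t
      rearrange = solve-∀ ℚ-ring

    ψ-src : ∀ y d → applyAff ψ y (src d) ≡ y (inject₁ (suc d)) - shiftℚ d * y top
    ψ-src y d = begin
      applyAff ψ y (src d)
        ≡⟨ applyAff-row ψ (src d) (trans (snoc-inject₁ _ _ (punchIn i d)) (insertAt-punchIn ψ-row i _ d))
                                  (trans (snoc-inject₁ _ _ (punchIn i d)) (insertAt-punchIn (λ _ → 0ℤ) i _ d)) y ⟩
      ⟪ ℤtoℚ ∘ ψ-row d , y ⟫ + 0ℚ
        ≡⟨ cong (_+ 0ℚ) (⟪row₂⟫ (inject₁ (suc d)) 1ℤ top (ℤ.- shift d) (FinP.fromℕ≢inject₁ ∘ sym) y) ⟩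
      1ℚ * y (inject₁ (suc d)) + ℤtoℚ (ℤ.- shift d) * y top + 0ℚ
        ≡⟨ cong (λ s → 1ℚ * y (inject₁ (suc d)) + s * y top + 0ℚ) (-shift≡ d) ⟩
      1ℚ * y (inject₁ (suc d)) + - shiftℚ d * y top + 0ℚ
        ≡⟨ rearrange (y (inject₁ (suc d))) (y top) (shiftℚ d) ⟩
      y (inject₁ (suc d)) - shiftℚ d * y top ∎
      where
      open ≡-Reasoning
      rearrange : ∀ s t D → 1ℚ * s + - D * t + 0ℚ ≡ s - D * t
      rearrange = solve-∀ ℚ-ring

    ψ-last : ∀ y → applyAff ψ y last ≡ y zero - y top
    ψ-last y = trans (applyAff-row ψ last (snoc-last (insertAt ψ-row i (row₁ top -1ℤ)) (row₂ zero 1ℤ top -1ℤ))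
                                         (snoc-last (insertAt (λ _ → 0ℤ) i 1ℤ) 0ℤ) y)
      (trans (cong (_+ 0ℚ) (⟪row₂⟫ zero 1ℤ top -1ℤ (λ ()) y)) (rearrange (y zero) (y top)))
      where
      rearrange : ∀ s t → 1ℚ * s + ℤtoℚ -1ℤ * t + 0ℚ ≡ s - t
      rearrange = solve-∀ ℚ-ring

    data PyramidCoord : Fin N → Set where
      y-first : PyramidCoord zero
      y-base  : ∀ d → PyramidCoord (inject₁ (suc d))
      y-apex  : PyramidCoord top

    pyramidCoord : ∀ r → PyramidCoord r
    pyramidCoord r with view r
    ... | ‵fromℕ               = y-apex
    ... | ‵inj₁ {i = zero}  _ = y-first
    ... | ‵inj₁ {i = suc d} _ = y-base d

    data LiftedCoord : Fin (suc N) → Set where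
      x-first  : LiftedCoord zero
      x-facet  : LiftedCoord j
      x-other  : ∀ d → LiftedCoord (src d)
      x-height : LiftedCoord last

    liftedCoord : ∀ r → LiftedCoord r
    liftedCoord zero = x-first
    liftedCoord (suc r) with view r
    ... | ‵fromℕ         = x-height
    ... | ‵inj₁ {i = c} _ with i Fin.≟ c
    ...   | yes refl = x-facet
    ...   | no  i≢c  =
      subst LiftedCoord (cong (suc ∘ inject₁) (FinP.punchIn-punchOut i≢c)) (x-other (punchOut i≢c))

    G : PtSet N
    G = pyramidOverHypersimplex k (suc n)

    apex : Pt N
    apex = extend apexBase 1ℚ

    baseVerts : List (Pt N)
    baseVerts = List.map (λ v → extend v 0ℚ) (hyperVerts k (suc n))

    extend-i≡1 : ∀ u h → Vec.lookup u i ≡ true → extend u h (inject₁ i) ≡ 1ℚ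
    extend-i≡1 u h uᵢ≡1 = trans (extend-inject₁ u h i) (cong b2ℚ uᵢ≡1)

    φ-vertex : ∀ b u h → Vec.lookup u i ≡ true →
      applyAff φ (extend (b ∷ u) h) ≐ extend (b ∷ Vec.removeAt u i) 0ℚ
    φ-vertex b u h uᵢ≡1 r with pyramidCoord r
    ... | y-first  = φ-first (extend (b ∷ u) h)
    ... | y-base d = begin
      applyAff φ (extend (b ∷ u) h) (inject₁ (suc d))         ≡⟨ φ-base (extend (b ∷ u) h) d ⟩
      extend u h (inject₁ (punchIn i d)) + shiftℚ d * (1ℚ - extend u h (inject₁ i))
        ≡⟨ cong₂ (λ s t → s + shiftℚ d * (1ℚ - t)) (extend-inject₁ u h (punchIn i d)) (extend-i≡1 u h uᵢ≡1) ⟩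
      b2ℚ (Vec.lookup u (punchIn i d)) + shiftℚ d * (1ℚ - 1ℚ) ≡⟨ no-shift _ (shiftℚ d) ⟩
      b2ℚ (Vec.lookup u (punchIn i d))                       ≡⟨ cong b2ℚ (sym (lookup-removeAt u i d)) ⟩
      b2ℚ (Vec.lookup (Vec.removeAt u i) d)                  ≡⟨ sym (extend-inject₁ (Vec.removeAt u i) 0ℚ d) ⟩
      extend (b ∷ Vec.removeAt u i) 0ℚ (inject₁ (suc d))     ∎
      where
      open ≡-Reasoning
      no-shift : ∀ s D → s + D * (1ℚ - 1ℚ) ≡ s
      no-shift = solve-∀ ℚ-ring
    ... | y-apex = trans (φ-top (extend (b ∷ u) h))
      (trans (cong (λ t → 1ℚ - t) (extend-i≡1 u h uᵢ≡1)) (sym (extend-last (b ∷ Vec.removeAt u i) 0ℚ)))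

    extend-lv-i : ∀ h → extend lv h (inject₁ i) ≡ 0ℚ
    extend-lv-i h = trans (extend-inject₁ lv h i) (cong b2ℚ lv-i)

    apex-first : apex zero ≡ 1ℚ
    apex-first = trans (extend-inject₁ apexBase 1ℚ zero) (cong b2ℚ apexBase-first)

    φ-v⋆ : applyAff φ (extend v⋆ 0ℚ) ≐ apex
    φ-v⋆ r with pyramidCoord r
    ... | y-first  = trans (φ-first (extend v⋆ 0ℚ)) (sym apex-first)
    ... | y-base d = begin
      applyAff φ (extend v⋆ 0ℚ) (inject₁ (suc d))
        ≡⟨ φ-base (extend v⋆ 0ℚ) d ⟩
      extend lv 0ℚ (inject₁ (punchIn i d)) + shiftℚ d * (1ℚ - extend lv 0ℚ (inject₁ i))
        ≡⟨ cong₂ (λ s t → s + shiftℚ d * (1ℚ - t)) (extend-inject₁ lv 0ℚ (punchIn i d)) (extend-lv-i 0ℚ) ⟩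
      b2ℚ (Vec.lookup lv (punchIn i d)) + shiftℚ d * (1ℚ - 0ℚ)
        ≡⟨ full-shift (b2ℚ (Vec.lookup apexBase (suc d))) (b2ℚ (Vec.lookup lv (punchIn i d))) ⟩
      b2ℚ (Vec.lookup apexBase (suc d))
        ≡⟨ sym (extend-inject₁ apexBase 1ℚ (suc d)) ⟩
      apex (inject₁ (suc d)) ∎
      where
      open ≡-Reasoning
      full-shift : ∀ a l → l + (a - l) * (1ℚ - 0ℚ) ≡ a
      full-shift = solve-∀ ℚ-ring
    ... | y-apex = trans (φ-top (extend v⋆ 0ℚ)) (trans (cong (λ t → 1ℚ - t) (extend-lv-i 0ℚ)) (sym (extend-last apexBase 1ℚ)))

    ψ-vertex : ∀ b v → applyAff ψ (extend (b ∷ v) 0ℚ) ≐ extend (b ∷ Vec.insertAt v i true) (b2ℚ b)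
    ψ-vertex b v r with liftedCoord r
    ... | x-first  = ψ-first (extend (b ∷ v) 0ℚ)
    ... | x-facet  = trans (ψ-facet (extend (b ∷ v) 0ℚ)) (trans (cong (λ t → 1ℚ - t) (extend-last (b ∷ v) 0ℚ))
                       (sym (extend-i≡1 (Vec.insertAt v i true) (b2ℚ b) (VecP.insertAt-lookup v i true))))
    ... | x-other d = begin
      applyAff ψ (extend (b ∷ v) 0ℚ) (src d)
        ≡⟨ ψ-src (extend (b ∷ v) 0ℚ) d ⟩
      extend v 0ℚ (inject₁ d) - shiftℚ d * extend (b ∷ v) 0ℚ top
        ≡⟨ cong₂ (λ s t → s - shiftℚ d * t) (extend-inject₁ v 0ℚ d) (extend-last (b ∷ v) 0ℚ) ⟩
      b2ℚ (Vec.lookup v d) - shiftℚ d * 0ℚ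
        ≡⟨ no-shift _ (shiftℚ d) ⟩
      b2ℚ (Vec.lookup v d)
        ≡⟨ cong b2ℚ (sym (VecP.insertAt-punchIn v i true d)) ⟩
      b2ℚ (Vec.lookup (Vec.insertAt v i true) (punchIn i d))
        ≡⟨ sym (extend-inject₁ (Vec.insertAt v i true) (b2ℚ b) (punchIn i d)) ⟩
      extend (b ∷ Vec.insertAt v i true) (b2ℚ b) (src d) ∎
      where
      open ≡-Reasoning
      no-shift : ∀ s D → s - D * 0ℚ ≡ s
      no-shift = solve-∀ ℚ-ring
    ... | x-height = trans (ψ-last (extend (b ∷ v) 0ℚ)) (trans (cong (λ t → b2ℚ b - t) (extend-last (b ∷ v) 0ℚ))
                       (trans (ℚP.+-identityʳ (b2ℚ b)) (sym (extend-last (b ∷ Vec.insertAt v i true) (b2ℚ b)))))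

    ψ-apex : applyAff ψ apex ≐ extend v⋆ 0ℚ
    ψ-apex r with liftedCoord r
    ... | x-first  = trans (ψ-first apex) apex-first
    ... | x-facet  = trans (ψ-facet apex) (trans (cong (λ t → 1ℚ - t) (extend-last apexBase 1ℚ)) (sym (extend-lv-i 0ℚ)))
    ... | x-other d = begin
      applyAff ψ apex (src d)
        ≡⟨ ψ-src apex d ⟩
      apex (inject₁ (suc d)) - shiftℚ d * apex top
        ≡⟨ cong₂ (λ s t → s - shiftℚ d * t) (extend-inject₁ apexBase 1ℚ (suc d)) (extend-last apexBase 1ℚ) ⟩
      b2ℚ (Vec.lookup apexBase (suc d)) - shiftℚ d * 1ℚ
        ≡⟨ unshift (b2ℚ (Vec.lookup apexBase (suc d))) (b2ℚ (Vec.lookup lv (punchIn i d))) ⟩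
      b2ℚ (Vec.lookup lv (punchIn i d))
        ≡⟨ sym (extend-inject₁ lv 0ℚ (punchIn i d)) ⟩
      extend v⋆ 0ℚ (src d) ∎
      where
      open ≡-Reasoning
      unshift : ∀ a l → a - (a - l) * 1ℚ ≡ l
      unshift = solve-∀ ℚ-ring
    ... | x-height = trans (ψ-last apex) (trans (cong₂ _-_ apex-first (extend-last apexBase 1ℚ)) (sym (extend-last v⋆ 0ℚ)))

    weight-removeAt-i : ∀ b u → Vec.lookup u i ≡ true → weight (b ∷ u) ≡ suc (weight (b ∷ Vec.removeAt u i))
    weight-removeAt-i true  u uᵢ≡1 = cong suc (weight-removeAt-i false u uᵢ≡1)
    weight-removeAt-i false u uᵢ≡1 = trans (weight-removeAt u i) (cong (λ t → b2ℕ t ℕ.+ weight (Vec.removeAt u i)) uᵢ≡1)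

    weight-insertAt-i : ∀ b v → weight (b ∷ Vec.insertAt v i true) ≡ suc (weight (b ∷ v))
    weight-insertAt-i true  v = cong suc (weight-insertAt-i false v)
    weight-insertAt-i false v = weight-insertAt v i true

    φ-F⊆G : ∀ x → F x → G (applyAff φ x)
    φ-F⊆G x (x∈P , fx≡0) =
      conv-face-image {L = liftedVerts K N} {M = baseVerts ++ [ apex ]} φ normal 1ℚ vertex-slack face-vertex x∈P (trans (sym (f≡1-⟪normal⟫ x)) fx≡0)
      where
      face-vertex : ∀ {p} → p ∈ liftedVerts K N → 1ℚ - ⟪ normal , p ⟫ ≡ 0ℚ → G (applyAff φ p)
      face-vertex p∈ slack≡0 with ∈-liftedVerts⁻ p∈
      ... | inj₁ refl = conv-resp {L = baseVerts ++ [ apex ]} (conv-∈ (∈-++⁺ʳ baseVerts (here refl))) (sym ∘ φ-v⋆)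
      ... | inj₂ (b ∷ u , w≡K , refl) with Vec.lookup u i in uᵢ
      ...   | true  = conv-resp {L = baseVerts ++ [ apex ]} (conv-∈ (∈-++⁺ˡ (∈-map⁺ (λ v → extend v 0ℚ) base∈)))
                        (sym ∘ φ-vertex b u (b2ℚ b) uᵢ)
        where
        base∈ : b ∷ Vec.removeAt u i ∈ hyperVerts k (suc n)
        base∈ = ∈-hyperVerts⁺ k (b ∷ Vec.removeAt u i) (ℕP.suc-injective (trans (sym (weight-removeAt-i b u uᵢ)) w≡K))
      ...   | false = ⊥-elim (ℚP.1≢0 (trans (sym (trans (f-vertex b u) (cong (λ t → 1ℚ - b2ℚ t) uᵢ)))
                                           (trans (f≡1-⟪normal⟫ (extend (b ∷ u) (b2ℚ b))) slack≡0)))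

    f∘ψ : ∀ y → f (applyAff ψ y) ≡ 0ℚ
    f∘ψ y = trans (cong₂ (λ s t → 1ℚ - s - t + applyAff ψ y last) (ψ-first y) (ψ-facet y))
      (trans (cong (λ t → 1ℚ - y zero - (1ℚ - y top) + t) (ψ-last y)) (cancel (y zero) (y top)))
      where
      cancel : ∀ a t → 1ℚ - a - (1ℚ - t) + (a - t) ≡ 0ℚ
      cancel = solve-∀ ℚ-ring

    ψ-G⊆F : ∀ y → G y → F (applyAff ψ y)
    ψ-G⊆F y y∈G = conv-image {L = baseVerts ++ [ apex ]} {M = liftedVerts K N} ψ pyramid-vertex y∈G , f∘ψ y
      where
      base-vertex : ∀ b v → weight (b ∷ v) ≡ k → P (extend (b ∷ Vec.insertAt v i true) (b2ℚ b))
      base-vertex b v w≡k = conv-∈ (∈-liftedVerts⁺ (b ∷ Vec.insertAt v i true) (trans (weight-insertAt-i b v) (cong suc w≡k))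
        (λ eq → true≢false (trans (sym (VecP.insertAt-lookup v i true)) (trans (cong (λ w → Vec.lookup (Vec.tail w) i) eq) lv-i))))
      pyramid-vertex : ∀ {p} → p ∈ baseVerts ++ [ apex ] → P (applyAff ψ p)
      pyramid-vertex p∈ with ∈-++⁻ baseVerts p∈
      ... | inj₂ (here refl) = conv-resp {L = liftedVerts K N} (conv-∈ v⋆∈liftedVerts) (sym ∘ ψ-apex)
      ... | inj₁ p∈base with ∈-map⁻ (λ v → extend v 0ℚ) p∈base
      ...   | b ∷ v , v∈ , refl =
        conv-resp {L = liftedVerts K N} (base-vertex b v (∈-hyperVerts⁻ k (suc n) v∈)) (sym ∘ ψ-vertex b v)

    ψ∘φ : ∀ x → F x → applyAff ψ (applyAff φ x) ≐ x
    ψ∘φ x (_ , fx≡0) r with liftedCoord r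
    ... | x-first   = trans (ψ-first (applyAff φ x)) (φ-first x)
    ... | x-facet   = trans (ψ-facet (applyAff φ x)) (trans (cong (λ t → 1ℚ - t) (φ-top x)) (1-[1-t] (x j)))
      where
      1-[1-t] : ∀ t → 1ℚ - (1ℚ - t) ≡ t
      1-[1-t] = solve-∀ ℚ-ring
    ... | x-other d = trans (ψ-src (applyAff φ x) d)
      (trans (cong₂ (λ s t → s - shiftℚ d * t) (φ-base x d) (φ-top x)) (unshift (x (src d)) (shiftℚ d) (x j)))
      where
      unshift : ∀ s D t → s + D * (1ℚ - t) - D * (1ℚ - t) ≡ s
      unshift = solve-∀ ℚ-ring
    ... | x-height  = trans (ψ-last (applyAff φ x))
      (trans (cong₂ _-_ (φ-first x) (φ-top x))
      (trans (via-f (x zero) (x j) (x last)) (trans (cong (λ t → x last - t) fx≡0) (ℚP.+-identityʳ (x last)))))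
      where
      via-f : ∀ a b c → a - (1ℚ - b) ≡ c - (1ℚ - a - b + c)
      via-f = solve-∀ ℚ-ring

    φ∘ψ : ∀ y → applyAff φ (applyAff ψ y) ≐ y
    φ∘ψ y r with pyramidCoord r
    ... | y-first  = trans (φ-first (applyAff ψ y)) (ψ-first y)
    ... | y-base d = trans (φ-base (applyAff ψ y) d)
      (trans (cong₂ (λ s t → s + shiftℚ d * (1ℚ - t)) (ψ-src y d) (ψ-facet y)) (reshift (y (inject₁ (suc d))) (shiftℚ d) (y top)))
      where
      reshift : ∀ s D t → s - D * t + D * (1ℚ - (1ℚ - t)) ≡ s
      reshift = solve-∀ ℚ-ring
    ... | y-apex   = trans (φ-top (applyAff ψ y)) (trans (cong (λ t → 1ℚ - t) (ψ-facet y)) (1-[1-t] (y top)))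
      where
      1-[1-t] : ∀ t → 1ℚ - (1ℚ - t) ≡ t
      1-[1-t] = solve-∀ ℚ-ring

    latticeIso : LatticeIso F G
    latticeIso = φ , ψ , φ-F⊆G , ψ-G⊆F , ψ∘φ , λ y _ → φ∘ψ y

    p₀∉facet : ∀ i′ → toℕ i′ ℕ.+ k ℕ.< suc n → i′ ≢ i → ¬ zeroSetIn P (fAff N (suc (inject₁ i′))) p₀
    p₀∉facet i′ i′+k≤n i′≢i (_ , f′≡0) = ℚP.1≢0 (trans (sym f′≡1) f′≡0)
      where
      f′≡1 : fAff N (suc (inject₁ i′)) p₀ ≡ 1ℚ
      f′≡1 = cong₂ (λ y z → 1ℚ - 0ℚ - y + z)
        (trans (extend-inject₁ u₀ 0ℚ i′) (cong b2ℚ (trans (u₀-other i′≢i) (lookup-lastVert-false k (suc n) i′ i′+k≤n))))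
        (extend-last (false ∷ u₀) 0ℚ)

    properties : (∀ x → P x → 0ℚ ≤ f x) × IsLowerFacet P F × LatticeIso F G
    properties = f-nonneg , (lowerFace , dimDrop) , latticeIso

open Facets using (module Facet)

open import Data.Nat using (ℕ; suc; _≤_; _+_; _∸_)
open import Data.Fin using (Fin; toℕ)
open import Data.Product using (Σ; _×_)
open import Relation.Nullary using (¬_)
open import Relation.Binary.PropositionalEquality using (_≡_)
open import Data.Rational using (0ℚ) renaming (_≤_ to _≤ℚ_)

open import Data.Nat using (zero; s≤s; _<_)
import Data.Nat.Properties as ℕP
open import Data.Fin using (zero; suc; inject₁)
import Data.Fin.Properties as FinP
open import Data.Fin.Relation.Unary.Top using (view; ‵fromℕ; ‵inj₁)
open import Data.Product using (∃-syntax; _,_)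
open import Data.Empty using (⊥-elim)
open import Relation.Binary.PropositionalEquality using (refl; sym; subst)

facetIndex : ∀ {k n} (j : Fin (suc (suc (suc n)))) → 1 ≤ toℕ j → toℕ j ≤ suc (suc n) ∸ suc k → k ≤ suc n →
  ∃[ i ] j ≡ suc (inject₁ i) × toℕ i + k < suc n
facetIndex {k} {n} (suc j) _ j≤ k≤1+n with view j
... | ‵fromℕ = ⊥-elim (ℕP.<-irrefl refl (ℕP.≤-trans (s≤s (ℕP.≤-reflexive (sym (FinP.toℕ-fromℕ (suc n)))))
                                                  (ℕP.≤-trans j≤ (ℕP.m∸n≤m (suc n) k))))
... | ‵inj₁ {i = i} _ = i , refl ,
  subst (λ m → suc m + k ≤ suc n) (FinP.toℕ-inject₁ i) (ℕP.m≤o∸n⇒m+n≤o (suc (toℕ (inject₁ i))) k≤1+n j≤)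

lemma4p7 : (k n : ℕ) → 2 ≤ k → k + 2 ≤ n →
    -- the coordinate x_i is given by its 0-based index j, i.e. i = toℕ j + 1,
    -- so i ∈ {2,…,n-k+1} ⇔ 1 ≤ toℕ j ≤ n - k
    ((j : Fin (suc n)) → 1 ≤ toℕ j → toℕ j ≤ n ∸ k →
      (∀ x → liftedHypersimplex k n x → 0ℚ ≤ℚ fAff n j x)
      × IsLowerFacet (liftedHypersimplex k n) (zeroSetIn (liftedHypersimplex k n) (fAff n j))
      × LatticeIso (zeroSetIn (liftedHypersimplex k n) (fAff n j))
                   (pyramidOverHypersimplex (k ∸ 1) (n ∸ 1)))
    × ((j j' : Fin (suc n)) → 1 ≤ toℕ j → toℕ j ≤ n ∸ k → 1 ≤ toℕ j' → toℕ j' ≤ n ∸ k →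
      ¬ (toℕ j ≡ toℕ j') →
      Σ _ λ x → zeroSetIn (liftedHypersimplex k n) (fAff n j) x
              × ¬ zeroSetIn (liftedHypersimplex k n) (fAff n j') x)
lemma4p7 zero          _             ()        _
lemma4p7 (suc k)       zero          _         ()
lemma4p7 (suc k)       (suc zero)    _         (s≤s k+2≤0) with () ← ℕP.m+n≤o⇒n≤o k k+2≤0
lemma4p7 (suc k)       (suc (suc n)) (s≤s 1≤k) (s≤s k+2≤1+n) = facet , distinct
  where
  k<n : k < n
  k<n = ℕP.≤-pred (subst (_≤ suc n) (ℕP.+-comm k 2) k+2≤1+n)

  k≤1+n : k ≤ suc n
  k≤1+n = ℕP.≤-trans (ℕP.<⇒≤ k<n) (ℕP.n≤1+n n)

  Δ̃ : PtSet (suc (suc (suc n)))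
  Δ̃ = liftedHypersimplex (suc k) (suc (suc n))

  facet : (j : Fin (suc (suc (suc n)))) → 1 ≤ toℕ j → toℕ j ≤ suc (suc n) ∸ suc k →
    (∀ x → Δ̃ x → 0ℚ ≤ℚ fAff (suc (suc n)) j x) × IsLowerFacet Δ̃ (zeroSetIn Δ̃ (fAff (suc (suc n)) j))
    × LatticeIso (zeroSetIn Δ̃ (fAff (suc (suc n)) j)) (pyramidOverHypersimplex k (suc n))
  facet j 1≤j j≤ with facetIndex j 1≤j j≤ k≤1+n
  ... | i , refl , i+k≤n = Facet.properties k n 1≤k k<n i i+k≤n

  distinct : (j j′ : Fin (suc (suc (suc n)))) → 1 ≤ toℕ j → toℕ j ≤ suc (suc n) ∸ suc k →
    1 ≤ toℕ j′ → toℕ j′ ≤ suc (suc n) ∸ suc k → ¬ toℕ j ≡ toℕ j′ →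
    Σ (Pt (suc (suc (suc n)))) λ x → zeroSetIn Δ̃ (fAff (suc (suc n)) j) x × ¬ zeroSetIn Δ̃ (fAff (suc (suc n)) j′) x
  distinct j j′ 1≤j j≤ 1≤j′ j′≤ j≢j′ with facetIndex j 1≤j j≤ k≤1+n | facetIndex j′ 1≤j′ j′≤ k≤1+n
  ... | i , refl , i+k≤n | i′ , refl , i′+k≤n = p₀ , p₀∈F , p₀∉facet i′ i′+k≤n λ { refl → j≢j′ refl }
    where open Facet k n 1≤k k<n i i+k≤n
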